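{- Let $m,k,l$ be positive integers, at most one of which equals $1$. Then for every signature $\sigma$, the signed graph $(\theta(2m,2k,2l),\sigma)$ is nonsingular, i.e. $\det A(\theta(2m,2k,2l),\sigma)\neq 0$.
   Context: For integers $p,l,q\geq 2$ with at most one of them equal to $2$, $\theta(p,l,q)$ denotes the graph obtained from three paths $P_p,P_l,P_q$ (with $p$, $l$, $q$ vertices respectively) by identifying their three initial vertices into one vertex and their three terminal vertices into one vertex. A signed graph $(G,\sigma)$ is a simple graph with $\sigma:E(G)\to\{+,-\}$; its adjacency matrix $A(G,\sigma)$ has $(i,j)$-entry $\sigma(v_iv_j)$ for edges and $0$ otherwise. Nonsingular means $\det A(G,\sigma)\neq 0$. -}

module Defs where

open import Data.Nat using (ℕ; zero; suc; _+_; _∸_)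
open import Data.Nat.Properties using (_≟_)
open import Data.Integer using (ℤ; +_; -_; _*_) renaming (_+_ to _+ℤ_)
open import Data.Fin using (Fin; toℕ; punchIn) renaming (zero to fzero; suc to fsuc)
open import Data.Bool using (Bool; true; false; _∧_; _∨_; if_then_else_)
open import Data.List using (List; []; _∷_; _++_)
open import Data.Bool.ListAction using (any)
open import Data.Product using (_×_; _,_)
open import Relation.Nullary.Decidable using (⌊_⌋)

-- Vertex labelling of θ(p,l,q) (p,l,q ≥ 2) on {0,…,p+l+q-5}:
--   0 = common initial vertex, 1 = common terminal vertex,
--   internal vertices of P_p : 2 … p-1            (p-2 of them),
--   internal vertices of P_l : p … p+l-3          (l-2 of them),
--   internal vertices of P_q : p+l-2 … p+l+q-5    (q-2 of them).

chain : ℕ → ℕ → List (ℕ × ℕ)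
chain s zero    = (s , 1) ∷ []
chain s (suc c) = (s , s + 1) ∷ chain (s + 1) c

pathEdges : ℕ → ℕ → List (ℕ × ℕ)
pathEdges s zero    = (0 , 1) ∷ []
pathEdges s (suc c) = (0 , s) ∷ chain s c

thetaEdges : ℕ → ℕ → ℕ → List (ℕ × ℕ)
thetaEdges p l q =
  pathEdges 2 (p ∸ 2) ++ pathEdges p (l ∸ 2) ++ pathEdges (p + l ∸ 2) (q ∸ 2)

thetaOrder : ℕ → ℕ → ℕ → ℕ
thetaOrder p l q = p + l + q ∸ 4

eqℕ : ℕ → ℕ → Bool
eqℕ a b = ⌊ a ≟ b ⌋

adjℕ : List (ℕ × ℕ) → ℕ → ℕ → Bool
adjℕ es a b = any (λ { (x , y) → (eqℕ x a ∧ eqℕ y b) ∨ (eqℕ x b ∧ eqℕ y a) }) es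

thetaAdj : (p l q : ℕ) → Fin (thetaOrder p l q) → Fin (thetaOrder p l q) → Bool
thetaAdj p l q i j = adjℕ (thetaEdges p l q) (toℕ i) (toℕ j)

data Sign : Set where
  plus minus : Sign

signVal : Sign → ℤ
signVal plus  = + 1
signVal minus = - (+ 1)

-- A signature of a graph on Fin n, given as a symmetric sign assignment
-- to vertex pairs (only its values on edges matter).
Signature : ℕ → Set
Signature n = Fin n → Fin n → Sign

signedAdj : ∀ {n} → (Fin n → Fin n → Bool) → Signature n → Fin n → Fin n → ℤ
signedAdj adj σ i j = if adj i j then signVal (σ i j) else + 0

sumFin : ∀ n → (Fin n → ℤ) → ℤ
sumFin zero    f = + 0
sumFin (suc n) f = f fzero +ℤ sumFin n (λ i → f (fsuc i))

altSign : ℕ → ℤ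
altSign zero          = + 1
altSign (suc zero)    = - (+ 1)
altSign (suc (suc k)) = altSign k

det : ∀ n → (Fin n → Fin n → ℤ) → ℤ
det zero    M = + 1
det (suc n) M =
  sumFin (suc n) (λ j → altSign (toℕ j) * (M fzero j * det n (λ r c → M (fsuc r) (punchIn j c))))

module Submission where

-- Reduced modulo 2, det A(θ,σ) becomes the determinant of the 0/1 adjacency matrix over GF(2),
-- whatever σ is, and over GF(2) the determinant is also the permanent.  In θ(2m,2k,2l) every internal
-- vertex of a path has exactly two neighbours, and the column of an internal vertex meets only the
-- rows of its own path; so in the expansion the choices along a path are forced, and a path with an
-- even number of internal vertices (2m−2, 2k−2, 2l−2) can be eliminated, leaving an explicit factor.
-- What remains is the expansion of the rows of the two branch vertices 0 and 1, a Boolean expression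
-- in which only the paths without internal vertices (the edge 0–1, present exactly when one of m, k, l
-- is 1) play a role; if at most one path is of this kind, it evaluates to 1.

open import Defs
open import Data.Bool using (Bool; true; false; not; _∧_; _∨_; _xor_; if_then_else_)
open import Data.Bool.Properties
  using (∧-zeroʳ; ∨-zeroʳ; ∨-identityʳ; ∧-identityʳ; ∨-assoc; xor-assoc; xor-comm; xor-identityʳ)
open import Data.Empty using (⊥-elim)
open import Data.Fin using (Fin; toℕ; punchIn) renaming (zero to fzero; suc to fsuc)
open import Data.Integer as ℤ using (ℤ; +_; -[1+_])
open import Data.Integer.Tactic.RingSolver using (solve-∀)
open import Data.List using (List; []; _∷_; _++_; [_]; map; tabulate)
open import Data.List.Properties using (++-assoc; ++-identityʳ; tabulate-cong; map-++; map-id)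
open import Data.List.Relation.Binary.Permutation.Propositional
  using (_↭_; prep; swap) renaming (refl to ↭-refl; trans to ↭-trans)
open import Data.List.Relation.Binary.Permutation.Propositional.Properties using (↭-length; shift; shifts; ++⁺ˡ)
open import Data.List.Relation.Binary.Pointwise as Pointwise using (Pointwise; []; _∷_)
open import Data.List.Relation.Unary.All using (All; []; _∷_) renaming (map to All-map)
open import Data.List.Relation.Unary.All.Properties using (++⁺)
open import Data.Nat using (ℕ; zero; suc; _+_; _*_; _∸_; _<_; _≤_; s≤s; z≤n)
open import Data.Nat.Properties
open import Data.Nat.Tactic.RingSolver as ℕ-Solver using ()
open import Data.Product using (_×_; _,_)
open import Data.Sum as Sum using (_⊎_; inj₁; inj₂; [_,_]′)
open import Data.Unit using (⊤; tt)
open import Function using (id)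
open import Relation.Binary.PropositionalEquality hiding ([_])
open import Relation.Nullary using (¬_; yes; no)

fromBool : Bool → ℤ
fromBool true  = + 1
fromBool false = + 0

record Parity (z : ℤ) (b : Bool) : Set where
  constructor _,_
  field
    quotient : ℤ
    decomposition : z ≡ fromBool b ℤ.+ + 2 ℤ.* quotient

fromBool-+ : ∀ b c → fromBool b ℤ.+ fromBool c ≡ fromBool (b xor c) ℤ.+ + 2 ℤ.* fromBool (b ∧ c)
fromBool-+ true  true  = refl
fromBool-+ true  false = refl
fromBool-+ false true  = refl
fromBool-+ false false = refl

fromBool-* : ∀ b c → fromBool b ℤ.* fromBool c ≡ fromBool (b ∧ c)
fromBool-* true  true  = refl
fromBool-* true  false = refl
fromBool-* false true  = refl
fromBool-* false false = refl

Parity-+ : ∀ {x y b c} → Parity x b → Parity y c → Parity (x ℤ.+ y) (b xor c)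
Parity-+ {b = b} {c} (q , refl) (r , refl) = fromBool (b ∧ c) ℤ.+ (q ℤ.+ r) , (begin
  (B ℤ.+ + 2 ℤ.* q) ℤ.+ (C ℤ.+ + 2 ℤ.* r)    ≡⟨ regroup B C q r ⟩
  (B ℤ.+ C) ℤ.+ + 2 ℤ.* (q ℤ.+ r)             ≡⟨ cong (ℤ._+ + 2 ℤ.* (q ℤ.+ r)) (fromBool-+ b c) ⟩
  (X ℤ.+ + 2 ℤ.* E) ℤ.+ + 2 ℤ.* (q ℤ.+ r)    ≡⟨ collect X E (q ℤ.+ r) ⟩
  X ℤ.+ + 2 ℤ.* (E ℤ.+ (q ℤ.+ r))             ∎)
  where
  open ≡-Reasoning
  B = fromBool b
  C = fromBool c
  X = fromBool (b xor c)
  E = fromBool (b ∧ c)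
  regroup : ∀ B C q r → (B ℤ.+ + 2 ℤ.* q) ℤ.+ (C ℤ.+ + 2 ℤ.* r) ≡ (B ℤ.+ C) ℤ.+ + 2 ℤ.* (q ℤ.+ r)
  regroup = solve-∀
  collect : ∀ X E s → (X ℤ.+ + 2 ℤ.* E) ℤ.+ + 2 ℤ.* s ≡ X ℤ.+ + 2 ℤ.* (E ℤ.+ s)
  collect = solve-∀

Parity-* : ∀ {x y b c} → Parity x b → Parity y c → Parity (x ℤ.* y) (b ∧ c)
Parity-* {b = b} {c} (q , refl) (r , refl) = B ℤ.* r ℤ.+ q ℤ.* C ℤ.+ + 2 ℤ.* (q ℤ.* r) , (begin
  (B ℤ.+ + 2 ℤ.* q) ℤ.* (C ℤ.+ + 2 ℤ.* r)               ≡⟨ expand B C q r ⟩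
  B ℤ.* C ℤ.+ + 2 ℤ.* (B ℤ.* r ℤ.+ q ℤ.* C ℤ.+ + 2 ℤ.* (q ℤ.* r))
    ≡⟨ cong (ℤ._+ + 2 ℤ.* (B ℤ.* r ℤ.+ q ℤ.* C ℤ.+ + 2 ℤ.* (q ℤ.* r))) (fromBool-* b c) ⟩
  fromBool (b ∧ c) ℤ.+ + 2 ℤ.* (B ℤ.* r ℤ.+ q ℤ.* C ℤ.+ + 2 ℤ.* (q ℤ.* r))  ∎)
  where
  open ≡-Reasoning
  B = fromBool b
  C = fromBool c
  expand : ∀ B C q r → (B ℤ.+ + 2 ℤ.* q) ℤ.* (C ℤ.+ + 2 ℤ.* r)
                       ≡ B ℤ.* C ℤ.+ + 2 ℤ.* (B ℤ.* r ℤ.+ q ℤ.* C ℤ.+ + 2 ℤ.* (q ℤ.* r))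
  expand = solve-∀

Parity-altSign : ∀ k → Parity (altSign k) true
Parity-altSign zero          = + 0 , refl
Parity-altSign (suc zero)    = -[1+ 0 ] , refl
Parity-altSign (suc (suc k)) = Parity-altSign k

Parity-signVal : ∀ s → Parity (signVal s) true
Parity-signVal plus  = + 0 , refl
Parity-signVal minus = -[1+ 0 ] , refl

odd-negative : ∀ m → + 1 ℤ.+ + 2 ℤ.* ℤ.- (+ 1 ℤ.+ m) ≡ ℤ.- (+ 1 ℤ.+ (m ℤ.+ m))
odd-negative = solve-∀

odd⇒≢0 : ∀ {z} → Parity z true → z ≢ + 0
odd⇒≢0 (+ zero , refl) ()
odd⇒≢0 (+ suc n , refl) ()
-- The right-hand side of odd-negative (+ n) computes to -[1+ n + n ].
odd⇒≢0 (-[1+ n ] , refl) eq with trans (sym eq) (odd-negative (+ n))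
... | ()

xorSum : ∀ n → (Fin n → Bool) → Bool
xorSum zero    f = false
xorSum (suc n) f = f fzero xor xorSum n (λ i → f (fsuc i))

det₂ : ∀ n → (Fin n → Fin n → Bool) → Bool
det₂ zero    B = true
det₂ (suc n) B = xorSum (suc n) (λ j → B fzero j ∧ det₂ n (λ r c → B (fsuc r) (punchIn j c)))

Parity-sumFin : ∀ n (f : Fin n → ℤ) (g : Fin n → Bool) →
                (∀ i → Parity (f i) (g i)) → Parity (sumFin n f) (xorSum n g)
Parity-sumFin zero    f g p = + 0 , refl
Parity-sumFin (suc n) f g p =
  Parity-+ (p fzero) (Parity-sumFin n (λ i → f (fsuc i)) (λ i → g (fsuc i)) (λ i → p (fsuc i)))

Parity-det : ∀ n (M : Fin n → Fin n → ℤ) (B : Fin n → Fin n → Bool) →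
             (∀ i j → Parity (M i j) (B i j)) → Parity (det n M) (det₂ n B)
Parity-det zero    M B p = + 0 , refl
Parity-det (suc n) M B p = Parity-sumFin (suc n) _ _ λ j →
  Parity-* (Parity-altSign (toℕ j))
           (Parity-* (p fzero j) (Parity-det n (minor j M) (minor j B) (λ r c → p (fsuc r) (punchIn j c))))
  where
  minor : ∀ {A : Set} → Fin (suc n) → (Fin (suc n) → Fin (suc n) → A) → Fin n → Fin n → A
  minor j M r c = M (fsuc r) (punchIn j c)

Parity-signedAdj : ∀ {n} (adj : Fin n → Fin n → Bool) σ i j → Parity (signedAdj adj σ i j) (adj i j)
Parity-signedAdj adj σ i j with adj i j
... | true  = Parity-signVal (σ i j)
... | false = + 0 , refl

det-signedAdj≢0 : ∀ n (adj : Fin n → Fin n → Bool) σ → det₂ n adj ≡ true → det n (signedAdj adj σ) ≢ + 0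
det-signedAdj≢0 n adj σ odd = odd⇒≢0 (subst (Parity _) odd (Parity-det n _ adj (Parity-signedAdj adj σ)))

pickXor : List ℕ → (ℕ → List ℕ → Bool) → Bool
pickXor []      f = false
pickXor (c ∷ L) f = f c L xor pickXor L (λ d R → f d (c ∷ R))

-- The GF(2) determinant of the matrix with rows `rs` restricted to the columns listed in `L`,
-- expanded along the first row (`pickXor` chooses the column of that row).
perm₂ : List (ℕ → Bool) → List ℕ → Bool
perm₂ []       []      = true
perm₂ []       (_ ∷ _) = false
perm₂ (r ∷ rs) L       = pickXor L (λ c R → r c ∧ perm₂ rs R)

pickXor-cong : ∀ L {f g} → (∀ d R → f d R ≡ g d R) → pickXor L f ≡ pickXor L g
pickXor-cong []      f≡g = refl
pickXor-cong (c ∷ L) f≡g = cong₂ _xor_ (f≡g c L) (pickXor-cong L (λ d R → f≡g d (c ∷ R)))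

pickXor-zeroOn : ∀ {P : ℕ → Set} L {f} → All P L → (∀ d R → P d → f d R ≡ false) → pickXor L f ≡ false
pickXor-zeroOn []      []         f≡0 = refl
pickXor-zeroOn (c ∷ L) (Pc ∷ PL) f≡0 rewrite f≡0 c L Pc = pickXor-zeroOn L PL (λ d R → f≡0 d (c ∷ R))

pickXor-zero : ∀ L {f} → (∀ d R → f d R ≡ false) → pickXor L f ≡ false
pickXor-zero []      f≡0 = refl
pickXor-zero (c ∷ L) f≡0 rewrite f≡0 c L = pickXor-zero L (λ d R → f≡0 d (c ∷ R))

pickXor-++ : ∀ P Q f → pickXor (P ++ Q) f ≡ pickXor P (λ d R → f d (R ++ Q)) xor pickXor Q (λ d R → f d (P ++ R))
pickXor-++ []      Q f = refl
pickXor-++ (c ∷ P) Q f = trans (cong (f c (P ++ Q) xor_) (pickXor-++ P Q (λ d R → f d (c ∷ R))))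
                               (sym (xor-assoc (f c (P ++ Q)) _ _))

Respects↭ : (ℕ → List ℕ → Bool) → Set
Respects↭ f = ∀ d {R R′} → R ↭ R′ → f d R ≡ f d R′

pickXor-↭ : ∀ {L L′} → L ↭ L′ → ∀ f → Respects↭ f → pickXor L f ≡ pickXor L′ f
pickXor-↭ ↭-refl       f resp = refl
pickXor-↭ (prep c p)   f resp =
  cong₂ _xor_ (resp c p) (pickXor-↭ p (λ d R → f d (c ∷ R)) (λ d q → resp d (prep c q)))
pickXor-↭ {c ∷ d ∷ L} {.d ∷ .c ∷ L′} (swap .c .d p) f resp = begin
  f c (d ∷ L) xor (f d (c ∷ L) xor pickXor L g)       ≡⟨ sym (xor-assoc (f c (d ∷ L)) _ _) ⟩
  (f c (d ∷ L) xor f d (c ∷ L)) xor pickXor L g       ≡⟨ cong₂ _xor_ (cong₂ _xor_ (resp c (prep d p)) (resp d (prep c p)))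
                                                                      (pickXor-↭ p g (λ e q → resp e (prep c (prep d q)))) ⟩
  (f c (d ∷ L′) xor f d (c ∷ L′)) xor pickXor L′ g    ≡⟨ cong₂ _xor_ (xor-comm (f c (d ∷ L′)) _)
                                                                      (pickXor-cong L′ (λ e R → resp e (swap c d ↭-refl))) ⟩
  (f d (c ∷ L′) xor f c (d ∷ L′)) xor pickXor L′ g′   ≡⟨ xor-assoc (f d (c ∷ L′)) _ _ ⟩
  f d (c ∷ L′) xor (f c (d ∷ L′) xor pickXor L′ g′)   ∎
  where
  open ≡-Reasoning
  g g′ : ℕ → List ℕ → Bool
  g  e R = f e (c ∷ d ∷ R)
  g′ e R = f e (d ∷ c ∷ R)
pickXor-↭ (↭-trans p q) f resp = trans (pickXor-↭ p f resp) (pickXor-↭ q f resp)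

perm₂-↭ : ∀ rs {L L′} → L ↭ L′ → perm₂ rs L ≡ perm₂ rs L′
perm₂-↭ []       {[]}    {[]}    p = refl
perm₂-↭ []       {_ ∷ _} {_ ∷ _} p = refl
perm₂-↭ []       {[]}    {_ ∷ _} p with ↭-length p
... | ()
perm₂-↭ []       {_ ∷ _} {[]}    p with ↭-length p
... | ()
perm₂-↭ (r ∷ rs) p = pickXor-↭ p _ (λ d q → cong (r d ∧_) (perm₂-↭ rs q))

ColumnZero : ℕ → List (ℕ → Bool) → Set
ColumnZero c rs = All (λ r → r c ≡ false) rs

RowZero : (ℕ → Bool) → List ℕ → Set
RowZero r L = All (λ d → r d ≡ false) L

perm₂-zeroColumn : ∀ rs c L → ColumnZero c rs → perm₂ rs (c ∷ L) ≡ false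
perm₂-zeroColumn []       c L []           = refl
perm₂-zeroColumn (r ∷ rs) c L (rc≡0 ∷ c0) rewrite rc≡0 =
  pickXor-zero L (λ d R → trans (cong (r d ∧_) (perm₂-zeroColumn rs c R c0)) (∧-zeroʳ (r d)))

perm₂-zeroRow : ∀ r rs L → RowZero r L → perm₂ (r ∷ rs) L ≡ false
perm₂-zeroRow r rs L r0 = pickXor-zeroOn L r0 (λ d R rd≡0 → cong (_∧ perm₂ rs R) rd≡0)

perm₂-unitRow : ∀ r rs c L → r c ≡ true → RowZero r L → perm₂ (r ∷ rs) (c ∷ L) ≡ perm₂ rs L
perm₂-unitRow r rs c L rc≡1 r0
  rewrite rc≡1 | pickXor-zeroOn L r0 (λ d R rd≡0 → cong (_∧ perm₂ rs (c ∷ R)) rd≡0) = xor-identityʳ (perm₂ rs L)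

perm₂-unitColumn : ∀ r rs c L → ColumnZero c rs → perm₂ (r ∷ rs) (c ∷ L) ≡ r c ∧ perm₂ rs L
perm₂-unitColumn r rs c L c0 =
  trans (cong ((r c ∧ perm₂ rs L) xor_)
              (pickXor-zero L (λ d R → trans (cong (r d ∧_) (perm₂-zeroColumn rs c R c0)) (∧-zeroʳ (r d)))))
        (xor-identityʳ _)

xorSum-cong : ∀ n {f g : Fin n → Bool} → (∀ i → f i ≡ g i) → xorSum n f ≡ xorSum n g
xorSum-cong zero    f≡g = refl
xorSum-cong (suc n) f≡g = cong₂ _xor_ (f≡g fzero) (xorSum-cong n (λ i → f≡g (fsuc i)))

pickXor-tabulate : ∀ n (L : Fin (suc n) → ℕ) f →
  pickXor (tabulate L) f ≡ xorSum (suc n) (λ j → f (L j) (tabulate (λ c → L (punchIn j c))))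
pickXor-tabulate zero    L f = refl
pickXor-tabulate (suc n) L f =
  cong (f (L fzero) (tabulate (λ c → L (fsuc c))) xor_)
       (pickXor-tabulate n (λ c → L (fsuc c)) (λ d R → f d (L fzero ∷ R)))

det₂≡perm₂ : ∀ n (R : Fin n → ℕ → Bool) (L : Fin n → ℕ) →
             det₂ n (λ i j → R i (L j)) ≡ perm₂ (tabulate R) (tabulate L)
det₂≡perm₂ zero    R L = refl
det₂≡perm₂ (suc n) R L = sym (trans
  (pickXor-tabulate n L (λ d R′ → R fzero d ∧ perm₂ (tabulate (λ i → R (fsuc i))) R′))
  (xorSum-cong (suc n) (λ j → cong (R fzero (L j) ∧_)
                                 (sym (det₂≡perm₂ n (λ i → R (fsuc i)) (λ c → L (punchIn j c)))))))

range : ℕ → ℕ → List ℕ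
range s zero    = []
range s (suc n) = s ∷ range (suc s) n

tabulate-range : ∀ {A : Set} n s (g : ℕ → A) → tabulate {n = n} (λ i → g (s + toℕ i)) ≡ map g (range s n)
tabulate-range zero    s g = refl
tabulate-range (suc n) s g = cong₂ _∷_ (cong g (+-identityʳ s))
  (trans (tabulate-cong (λ i → cong g (+-suc s (toℕ i)))) (tabulate-range n (suc s) g))

eqℕ-refl : ∀ a → eqℕ a a ≡ true
eqℕ-refl a with a ≟ a
... | yes _   = refl
... | no a≢a = ⊥-elim (a≢a refl)

eqℕ-≢ : ∀ {a b} → a ≢ b → eqℕ a b ≡ false
eqℕ-≢ {a} {b} a≢b with a ≟ b
... | yes a≡b = ⊥-elim (a≢b a≡b)
... | no _    = refl

pairRow : ℕ → ℕ → ℕ → Bool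
pairRow p n w = eqℕ w p ∨ eqℕ w n

pairRow-≢ : ∀ {p n w} → w ≢ p → w ≢ n → pairRow p n w ≡ false
pairRow-≢ w≢p w≢n rewrite eqℕ-≢ w≢p | eqℕ-≢ w≢n = refl

pairRow-left : ∀ p n → pairRow p n p ≡ true
pairRow-left p n rewrite eqℕ-refl p = refl

pairRow-right : ∀ p n → pairRow p n n ≡ true
pairRow-right p n rewrite eqℕ-refl n = ∨-zeroʳ _

-- The rows of the internal vertices s, s+1, …, s+t−1 of a path x – s – ⋯ – s+t−1 – y.
pathRows : ℕ → ℕ → ℕ → ℕ → List (ℕ → Bool)
pathRows x s zero          y = []
pathRows x s (suc zero)    y = pairRow x y ∷ []
pathRows x s (suc (suc t)) y = pairRow x (suc s) ∷ pathRows s (suc s) (suc t) y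

pathRows-columnZero : ∀ t x s y w → w ≢ x → w ≢ y → w < s → ColumnZero w (pathRows x s t y)
pathRows-columnZero zero          x s y w w≢x w≢y w<s = []
pathRows-columnZero (suc zero)    x s y w w≢x w≢y w<s = pairRow-≢ w≢x w≢y ∷ []
pathRows-columnZero (suc (suc t)) x s y w w≢x w≢y w<s =
  pairRow-≢ w≢x (<⇒≢ (<-trans w<s (n<1+n s))) ∷ pathRows-columnZero (suc t) s (suc s) y w (<⇒≢ w<s) w≢y (<-trans w<s (n<1+n s))

opt : Bool → ℕ → List ℕ
opt true  c = c ∷ []
opt false c = []

All-opt : ∀ {P : ℕ → Set} b c → P c → All P (opt b c)
All-opt true  c Pc = Pc ∷ []
All-opt false c Pc = []

tailColumns : ℕ → ℕ → Bool → List ℕ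
tailColumns u zero          γ = []
tailColumns u (suc zero)    γ = opt γ (suc u)
tailColumns u (suc (suc r)) γ = suc u ∷ tailColumns (suc u) (suc r) γ

firstPresent : ℕ → Bool → Bool
firstPresent zero    γ = γ
firstPresent (suc r) γ = true

tailColumns-suc : ∀ u r γ → tailColumns u (suc r) γ ≡ opt (firstPresent r γ) (suc u) ++ tailColumns (suc u) r γ
tailColumns-suc u zero    γ = sym (++-identityʳ (opt γ (suc u)))
tailColumns-suc u (suc r) γ = refl

tailColumns-bounds : ∀ u r γ → All (λ w → u < w × w ≤ u + r) (tailColumns u r γ)
tailColumns-bounds u zero          γ = []
tailColumns-bounds u (suc zero)    γ = All-opt γ (suc u) (≤-refl , ≤-reflexive (sym (+-comm u 1)))
tailColumns-bounds u (suc (suc r)) γ =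
  (≤-refl , ≤-trans (m≤m+n (suc u) (suc r)) (≤-reflexive (sym (+-suc u (suc r)))))
  ∷ All-map (λ (u<w , w≤) → <-trans (n<1+n u) u<w , ≤-trans w≤ (≤-reflexive (sym (+-suc u (suc r)))))
            (tailColumns-bounds (suc u) (suc r) γ)

-- The columns of a path can only be covered by the rows of that path, so in the
-- expansion the row of vertex u+1 (neighbours u and u+2) must take column u whenever it is still
-- free, and column u+2 otherwise.  `sweep a b r γ` follows these forced choices, where a and b say
-- whether the columns u and u+1 are still free; it returns whether they succeed and whether the
-- last row ends up taking its outer neighbour y.
sweep : Bool → Bool → ℕ → Bool → Bool × Bool
sweep a b zero    γ = not b , not a
sweep a b (suc r) γ =
  if a then sweep b (firstPresent r γ) r γ
  else (if firstPresent r γ then sweep b false r γ else (false , false))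

sweepValue : Bool × Bool → Bool → (List ℕ → Bool) → ℕ → List ℕ → Bool
sweepValue (ok , usesY) δ K y M = ok ∧ (if usesY then δ ∧ K M else K (opt δ y ++ M))

pairRow-inert : ∀ u y {w} → y < u → (w < u × w ≢ y) ⊎ suc u < w → pairRow u y w ≡ false
pairRow-inert u y y<u (inj₁ (w<u , w≢y)) = pairRow-≢ (<⇒≢ w<u) w≢y
pairRow-inert u y y<u (inj₂ u<w)         = pairRow-≢ (>⇒≢ (<-trans (n<1+n u) u<w)) (>⇒≢ (<-trans (<-trans y<u (n<1+n u)) u<w))

perm₂-sweep-last : ∀ u a b δ y ls M →
  (∀ w → u ≤ w → w ≤ suc u → ColumnZero w ls) → y < u → All (λ w → (w < u × w ≢ y) ⊎ suc u < w) M →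
  perm₂ (pairRow u y ∷ ls) (opt a u ++ opt b (suc u) ++ opt δ y ++ M) ≡ sweepValue (sweep a b 0 false) δ (perm₂ ls) y M
perm₂-sweep-last u a true δ y ls M zeroOnPath y<u inert =
  trans (perm₂-↭ (pairRow u y ∷ ls) (shift (suc u) (opt a u) (opt δ y ++ M)))
        (perm₂-zeroColumn (pairRow u y ∷ ls) (suc u) _
          (pairRow-≢ (>⇒≢ (n<1+n u)) (>⇒≢ (<-trans y<u (n<1+n u))) ∷ zeroOnPath (suc u) (n≤1+n u) ≤-refl))
perm₂-sweep-last u true false δ y ls M zeroOnPath y<u inert =
  trans (perm₂-unitColumn (pairRow u y) ls u (opt δ y ++ M) (zeroOnPath u ≤-refl (n≤1+n u)))
        (cong (_∧ perm₂ ls (opt δ y ++ M)) (pairRow-left u y))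
perm₂-sweep-last u false false true y ls M zeroOnPath y<u inert =
  perm₂-unitRow (pairRow u y) ls y M (pairRow-right u y) (All-map (pairRow-inert u y y<u) inert)
perm₂-sweep-last u false false false y ls M zeroOnPath y<u inert =
  perm₂-zeroRow (pairRow u y) ls M (All-map (pairRow-inert u y y<u) inert)

perm₂-sweep : ∀ r u a b γ δ y ls M →
  (∀ w → u ≤ w → w ≤ suc (u + r) → ColumnZero w ls) → y < u → All (λ w → (w < u × w ≢ y) ⊎ suc (u + r) < w) M →
  perm₂ (pathRows u (suc u) (suc r) y ++ ls) (opt a u ++ opt b (suc u) ++ tailColumns (suc u) r γ ++ opt δ y ++ M)
    ≡ sweepValue (sweep a b r γ) δ (perm₂ ls) y M
perm₂-sweep zero u a b γ δ y ls M zeroOnPath y<u inert =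
  perm₂-sweep-last u a b δ y ls M (λ w u≤w w≤ → zeroOnPath w u≤w (subst (w ≤_) (sym u+0) w≤)) y<u
    (All-map (λ { (inj₁ below) → inj₁ below ; {w} (inj₂ above) → inj₂ (subst (_< w) u+0 above) }) inert)
  where
  u+0 : suc (u + 0) ≡ suc u
  u+0 = cong suc (+-identityʳ u)
perm₂-sweep (suc r) u a b γ δ y ls M zeroOnPath y<u inert =
  trans (cong (perm₂ (row ∷ rows)) columns≡) (forced a (firstPresent r γ))
  where
  row = pairRow u (suc (suc u))
  rows = pathRows (suc u) (suc (suc u)) (suc r) y ++ ls
  rest = tailColumns (suc (suc u)) r γ ++ opt δ y ++ M
  columns≡ : opt a u ++ opt b (suc u) ++ tailColumns (suc u) (suc r) γ ++ opt δ y ++ M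
           ≡ opt a u ++ opt b (suc u) ++ opt (firstPresent r γ) (suc (suc u)) ++ rest
  columns≡ = cong (λ X → opt a u ++ opt b (suc u) ++ X)
    (trans (cong (_++ opt δ y ++ M) (tailColumns-suc (suc u) r γ)) (++-assoc (opt (firstPresent r γ) (suc (suc u))) _ _))
  end≡ : suc (u + suc r) ≡ suc (suc u + r)
  end≡ = cong suc (+-suc u r)
  sweep-rest : ∀ a′ b′ → perm₂ rows (opt a′ (suc u) ++ opt b′ (suc (suc u)) ++ rest) ≡ sweepValue (sweep a′ b′ r γ) δ (perm₂ ls) y M
  sweep-rest a′ b′ = perm₂-sweep r (suc u) a′ b′ γ δ y ls M
    (λ w 1+u≤w w≤ → zeroOnPath w (≤-trans (n≤1+n u) 1+u≤w) (subst (w ≤_) (sym end≡) w≤))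
    (<-trans y<u (n<1+n u))
    (All-map (λ { (inj₁ (w<u , w≢y)) → inj₁ (<-trans w<u (n<1+n u) , w≢y) ; {w} (inj₂ above) → inj₂ (subst (_< w) end≡ above) }) inert)
  2+u≤end : suc (suc u) ≤ suc (u + suc r)
  2+u≤end = s≤s (≤-trans (m≤m+n (suc u) r) (≤-reflexive (sym (+-suc u r))))
  u<2+u : u < suc (suc u)
  u<2+u = <-trans (n<1+n u) (n<1+n (suc u))
  row-inert : RowZero row (opt b (suc u) ++ rest)
  row-inert = ++⁺ (All-opt b (suc u) (pairRow-≢ (>⇒≢ (n<1+n u)) (<⇒≢ (n<1+n (suc u)))))
    (++⁺ (All-map (λ (2+u<w , _) → pairRow-≢ (>⇒≢ (<-trans u<2+u 2+u<w)) (>⇒≢ 2+u<w)) (tailColumns-bounds (suc (suc u)) r γ))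
    (++⁺ (All-opt δ y (pairRow-≢ (<⇒≢ y<u) (<⇒≢ (<-trans y<u u<2+u))))
         (All-map (λ { (inj₁ (w<u , _)) → pairRow-≢ (<⇒≢ w<u) (<⇒≢ (<-trans w<u u<2+u))
                     ; (inj₂ end<w) → pairRow-≢ (>⇒≢ (<-trans u<2+u (≤-<-trans 2+u≤end end<w))) (>⇒≢ (≤-<-trans 2+u≤end end<w)) }) inert)))
  forced : ∀ a f → perm₂ (row ∷ rows) (opt a u ++ opt b (suc u) ++ opt f (suc (suc u)) ++ rest)
         ≡ sweepValue (if a then sweep b f r γ else (if f then sweep b false r γ else (false , false))) δ (perm₂ ls) y M
  forced true f = begin
    perm₂ (row ∷ rows) (u ∷ opt b (suc u) ++ opt f (suc (suc u)) ++ rest)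
      ≡⟨ perm₂-unitColumn row rows u (opt b (suc u) ++ opt f (suc (suc u)) ++ rest)
           (++⁺ (pathRows-columnZero (suc r) (suc u) (suc (suc u)) y u (<⇒≢ (n<1+n u)) (>⇒≢ y<u) u<2+u)
                (zeroOnPath u ≤-refl (≤-trans (n≤1+n u) (s≤s (m≤m+n u (suc r)))))) ⟩
    row u ∧ perm₂ rows (opt b (suc u) ++ opt f (suc (suc u)) ++ rest)
      ≡⟨ cong (_∧ perm₂ rows (opt b (suc u) ++ opt f (suc (suc u)) ++ rest)) (pairRow-left u (suc (suc u))) ⟩
    perm₂ rows (opt b (suc u) ++ opt f (suc (suc u)) ++ rest)
      ≡⟨ sweep-rest b f ⟩
    sweepValue (sweep b f r γ) δ (perm₂ ls) y M ∎
    where open ≡-Reasoning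
  forced false true = trans (perm₂-↭ (row ∷ rows) (shift (suc (suc u)) (opt b (suc u)) rest))
    (trans (perm₂-unitRow row rows (suc (suc u)) (opt b (suc u) ++ rest) (pairRow-right u (suc (suc u))) row-inert)
           (sweep-rest b false))
  forced false false = perm₂-zeroRow row rows (opt b (suc u) ++ rest) row-inert

pickXor-skipZero : ∀ ρ (g : List ℕ → Bool) P Q → RowZero ρ P →
  pickXor (P ++ Q) (λ d R → ρ d ∧ g R) ≡ pickXor Q (λ d R → ρ d ∧ g (P ++ R))
pickXor-skipZero ρ g P Q ρ0 =
  trans (pickXor-++ P Q (λ d R → ρ d ∧ g R))
        (cong (_xor pickXor Q (λ d R → ρ d ∧ g (P ++ R))) (pickXor-zeroOn P ρ0 (λ d R ρd≡0 → cong (_∧ g (R ++ Q)) ρd≡0)))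

pickXor-unitRow : ∀ ρ (g : List ℕ → Bool) P₁ P₂ f c Q → RowZero ρ P₁ → RowZero ρ P₂ → RowZero ρ Q → ρ c ≡ true →
  pickXor (P₁ ++ P₂ ++ opt f c ++ Q) (λ d R → ρ d ∧ g R) ≡ f ∧ g (P₁ ++ P₂ ++ Q)
pickXor-unitRow ρ g P₁ P₂ f c Q ρ0₁ ρ0₂ ρ0Q ρc≡1 =
  trans (pickXor-skipZero ρ g P₁ _ ρ0₁) (trans (pickXor-skipZero ρ (λ R → g (P₁ ++ R)) P₂ _ ρ0₂) (at f))
  where
  at : ∀ f → pickXor (opt f c ++ Q) (λ d R → ρ d ∧ g (P₁ ++ P₂ ++ R)) ≡ f ∧ g (P₁ ++ P₂ ++ Q)
  at true  rewrite ρc≡1 | pickXor-zeroOn Q ρ0Q (λ d R e → cong (_∧ g (P₁ ++ P₂ ++ c ∷ R)) e) = xor-identityʳ _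
  at false = pickXor-zeroOn Q ρ0Q (λ d R e → cong (_∧ g (P₁ ++ P₂ ++ R)) e)

2*-suc : ∀ n → 2 * suc n ≡ suc (suc (2 * n))
2*-suc n = cong suc (+-suc n (n + 0))

sweep-suc-suc : ∀ a b r γ → sweep a b (suc (suc r)) γ ≡ sweep b a (suc r) γ
sweep-suc-suc true  b r γ = refl
sweep-suc-suc false b r γ = refl

sweepDone : Bool → Bool → (List ℕ → Bool) → ℕ → List ℕ → Bool
sweepDone β δ K y M = sweepValue (true , not β) δ K y M

sweep-odd : ∀ n a b γ δ K y M → sweepValue (sweep a b (suc (2 * n)) γ) δ K y M ≡ (a xor γ) ∧ sweepDone b δ K y M
sweep-odd zero    true  b γ     δ K y M = refl
sweep-odd zero    false b true  δ K y M = refl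
sweep-odd zero    false b false δ K y M = refl
sweep-odd (suc n) a     b γ     δ K y M = begin
  sweepValue (sweep a b (suc (2 * suc n)) γ) δ K y M        ≡⟨ cong (λ k → sweepValue (sweep a b (suc k) γ) δ K y M) (2*-suc n) ⟩
  sweepValue (sweep a b (suc (suc (suc (2 * n)))) γ) δ K y M ≡⟨ cong (λ p → sweepValue p δ K y M)
                                                                      (trans (sweep-suc-suc a b (suc (2 * n)) γ) (sweep-suc-suc b a (2 * n) γ)) ⟩
  sweepValue (sweep a b (suc (2 * n)) γ) δ K y M             ≡⟨ sweep-odd n a b γ δ K y M ⟩
  (a xor γ) ∧ sweepDone b δ K y M                            ∎
  where open ≡-Reasoning

sweep-even-firstPresent : ∀ n β γ δ K y M →
  sweepValue (sweep β (firstPresent (2 * n) γ) (2 * n) γ) δ K y M ≡ not γ ∧ sweepDone β δ K y M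
sweep-even-firstPresent zero    β γ δ K y M = refl
sweep-even-firstPresent (suc n) β γ δ K y M =
  trans (cong (λ k → sweepValue (sweep β (firstPresent k γ) k γ) δ K y M) (2*-suc n))
        (trans (cong (λ p → sweepValue p δ K y M) (sweep-suc-suc β true (2 * n) γ)) (sweep-odd n true β γ δ K y M))

sweep-even-firstAbsent : ∀ n β γ δ K y M →
  firstPresent (2 * n) γ ∧ sweepValue (sweep β false (2 * n) γ) δ K y M ≡ γ ∧ sweepDone β δ K y M
sweep-even-firstAbsent zero    β γ δ K y M = refl
sweep-even-firstAbsent (suc n) β γ δ K y M =
  trans (cong (λ k → firstPresent k γ ∧ sweepValue (sweep β false k γ) δ K y M) (2*-suc n))
        (trans (cong (λ p → sweepValue p δ K y M) (sweep-suc-suc β false (2 * n) γ)) (sweep-odd n false β γ δ K y M))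

moveToBack : ∀ (o a₁ a₂ a₃ Z : List ℕ) → o ++ a₁ ++ a₂ ++ a₃ ++ Z ↭ a₁ ++ a₂ ++ a₃ ++ o ++ Z
moveToBack o a₁ a₂ a₃ Z = ↭-trans (shifts o a₁) (++⁺ˡ a₁ (↭-trans (shifts o a₂) (++⁺ˡ a₂ (shifts o a₃))))

sweepDone-combine : ∀ ls x y M α β γ δ →
  (α ∧ (not γ ∧ sweepDone β δ (perm₂ ls) y M)) xor (γ ∧ sweepDone β δ (perm₂ ls) y (opt α x ++ M))
    ≡ ((γ ∨ α) ∧ (β ∨ δ)) ∧ perm₂ ls (opt (α ∧ γ) x ++ opt (δ ∧ β) y ++ M)
sweepDone-combine ls x y M true  true  true  true  = perm₂-↭ ls (shifts (opt true y) (opt true x))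
sweepDone-combine ls x y M true  true  true  false = refl
sweepDone-combine ls x y M false true  true  true  = refl
sweepDone-combine ls x y M false true  true  false = refl
sweepDone-combine ls x y M true  false true  true  = refl
sweepDone-combine ls x y M true  false true  false = refl
sweepDone-combine ls x y M false false true  true  = refl
sweepDone-combine ls x y M false false true  false = refl
sweepDone-combine ls x y M true  true  false true  = xor-identityʳ _
sweepDone-combine ls x y M true  true  false false = xor-identityʳ _
sweepDone-combine ls x y M true  false false true  = xor-identityʳ _
sweepDone-combine ls x y M true  false false false = refl
sweepDone-combine ls x y M false β     false δ     = refl

-- α, δ, β, γ say whether the columns x, y, s and s+2n+1 are present.
perm₂-evenPath⁺ : ∀ n x s y α δ β γ ls M → x < s → y < s → x ≢ y →
  (∀ w → s ≤ w → w ≤ suc (s + 2 * n) → ColumnZero w ls) →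
  All (λ w → (w < s × w ≢ x × w ≢ y) ⊎ suc (s + 2 * n) < w) M →
  perm₂ (pathRows x s (suc (suc (2 * n))) y ++ ls) (opt α x ++ opt δ y ++ opt β s ++ tailColumns s (suc (2 * n)) γ ++ M)
    ≡ ((γ ∨ α) ∧ (β ∨ δ)) ∧ perm₂ ls (opt (α ∧ γ) x ++ opt (δ ∧ β) y ++ M)
perm₂-evenPath⁺ n x s y α δ β γ ls M x<s y<s x≢y zeroOnPath inert = begin
  perm₂ (row ∷ rows) (opt α x ++ opt δ y ++ opt β s ++ tailColumns s (suc r) γ ++ M)
    ≡⟨ cong (λ X → perm₂ (row ∷ rows) (opt α x ++ opt δ y ++ opt β s ++ X))
            (trans (cong (_++ M) (tailColumns-suc s r γ)) (++-assoc (opt f (suc s)) T M)) ⟩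
  perm₂ (row ∷ rows) (opt α x ++ columns)
    ≡⟨ expandRow α ⟩
  (α ∧ perm₂ rows columns) xor (f ∧ perm₂ rows (opt α x ++ opt δ y ++ opt β s ++ T ++ M))
    ≡⟨ cong₂ (λ A B → (α ∧ A) xor (f ∧ B)) sweepWithX (sweepWithoutX α) ⟩
  (α ∧ sweepValue (sweep β f r γ) δ K y M) xor (f ∧ sweepValue (sweep β false r γ) δ K y (opt α x ++ M))
    ≡⟨ cong₂ (λ A B → (α ∧ A) xor B) (sweep-even-firstPresent n β γ δ K y M) (sweep-even-firstAbsent n β γ δ K y (opt α x ++ M)) ⟩
  (α ∧ (not γ ∧ sweepDone β δ K y M)) xor (γ ∧ sweepDone β δ K y (opt α x ++ M))
    ≡⟨ sweepDone-combine ls x y M α β γ δ ⟩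
  ((γ ∨ α) ∧ (β ∨ δ)) ∧ K (opt (α ∧ γ) x ++ opt (δ ∧ β) y ++ M) ∎
  where
  open ≡-Reasoning
  r = 2 * n
  f = firstPresent r γ
  T = tailColumns (suc s) r γ
  K = perm₂ ls
  row = pairRow x (suc s)
  rows = pathRows s (suc s) (suc r) y ++ ls
  columns = opt δ y ++ opt β s ++ opt f (suc s) ++ T ++ M
  s<1+s = n<1+n s
  end<w⇒1+s<w : ∀ {w} → suc (s + r) < w → suc s < w
  end<w⇒1+s<w = ≤-<-trans (s≤s (m≤m+n s r))
  row-inert : RowZero row (T ++ M)
  row-inert = ++⁺
    (All-map (λ (1+s<w , _) → pairRow-≢ (>⇒≢ (<-trans x<s (<-trans s<1+s 1+s<w))) (>⇒≢ 1+s<w)) (tailColumns-bounds (suc s) r γ))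
    (All-map (λ { (inj₁ (w<s , w≢x , _)) → pairRow-≢ w≢x (<⇒≢ (<-trans w<s s<1+s))
                ; (inj₂ end<w) → pairRow-≢ (>⇒≢ (<-trans x<s (<-trans s<1+s (end<w⇒1+s<w end<w)))) (>⇒≢ (end<w⇒1+s<w end<w)) }) inert)
  expandRow : ∀ α → perm₂ (row ∷ rows) (opt α x ++ columns)
                    ≡ (α ∧ perm₂ rows columns) xor (f ∧ perm₂ rows (opt α x ++ opt δ y ++ opt β s ++ T ++ M))
  expandRow α = trans (at α) (cong ((α ∧ perm₂ rows columns) xor_)
    (pickXor-unitRow row (λ R → perm₂ rows (opt α x ++ R)) (opt δ y) (opt β s) f (suc s) (T ++ M)
      (All-opt δ y (pairRow-≢ (≢-sym x≢y) (<⇒≢ (<-trans y<s s<1+s))))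
      (All-opt β s (pairRow-≢ (>⇒≢ x<s) (<⇒≢ s<1+s)))
      row-inert (pairRow-right x (suc s))))
    where
    at : ∀ α → perm₂ (row ∷ rows) (opt α x ++ columns)
             ≡ (α ∧ perm₂ rows columns) xor pickXor columns (λ d R → row d ∧ perm₂ rows (opt α x ++ R))
    at true  = cong (_xor pickXor columns (λ d R → row d ∧ perm₂ rows (x ∷ R))) (cong (_∧ perm₂ rows columns) (pairRow-left x (suc s)))
    at false = refl
  inertInRest : All (λ w → (w < s × w ≢ y) ⊎ suc (s + r) < w) M
  inertInRest = All-map (λ { (inj₁ (w<s , _ , w≢y)) → inj₁ (w<s , w≢y) ; (inj₂ end<w) → inj₂ end<w }) inert
  sweepWithX : perm₂ rows columns ≡ sweepValue (sweep β f r γ) δ K y M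
  sweepWithX = trans (perm₂-↭ rows (moveToBack (opt δ y) (opt β s) (opt f (suc s)) T M))
                     (perm₂-sweep r s β f γ δ y ls M zeroOnPath y<s inertInRest)
  sweepWithoutX : ∀ a → perm₂ rows (opt a x ++ opt δ y ++ opt β s ++ T ++ M) ≡ sweepValue (sweep β false r γ) δ K y (opt a x ++ M)
  sweepWithoutX a =
    trans (perm₂-↭ rows (↭-trans (shifts (opt a x) (opt δ y)) (++⁺ˡ (opt δ y) (moveToBack (opt a x) (opt β s) [] T M))))
    (trans (perm₂-↭ rows (moveToBack (opt δ y) (opt β s) [] T (opt a x ++ M)))
           (perm₂-sweep r s β false γ δ y ls (opt a x ++ M) zeroOnPath y<s (++⁺ (All-opt a x (inj₁ (x<s , x≢y))) inertInRest)))

eqℕ-sym : ∀ a b → eqℕ a b ≡ eqℕ b a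
eqℕ-sym a b with a ≟ b | b ≟ a
... | yes _   | yes _   = refl
... | no _    | no _    = refl
... | yes a≡b | no b≢a  = ⊥-elim (b≢a (sym a≡b))
... | no a≢b  | yes b≡a = ⊥-elim (a≢b (sym b≡a))

joins : ℕ × ℕ → ℕ → ℕ → Bool
joins (x , y) a b = (eqℕ x a ∧ eqℕ y b) ∨ (eqℕ x b ∧ eqℕ y a)

adjℕ-++ : ∀ xs ys v w → adjℕ (xs ++ ys) v w ≡ adjℕ xs v w ∨ adjℕ ys v w
adjℕ-++ []       ys v w = refl
adjℕ-++ (e ∷ xs) ys v w = trans (cong (joins e v w ∨_) (adjℕ-++ xs ys v w)) (sym (∨-assoc (joins e v w) _ _))

joins-≢ : ∀ {x y v} w → x ≢ v → y ≢ v → joins (x , y) v w ≡ false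
joins-≢ {x} w x≢v y≢v rewrite eqℕ-≢ x≢v | eqℕ-≢ y≢v = ∧-zeroʳ (eqℕ x w)

joins-fst : ∀ {x y} w → y ≢ x → joins (x , y) x w ≡ eqℕ w y
joins-fst {x} {y} w y≢x rewrite eqℕ-refl x | eqℕ-≢ y≢x | ∧-zeroʳ (eqℕ x w) = trans (∨-identityʳ _) (eqℕ-sym y w)

joins-snd : ∀ {x y} w → x ≢ y → joins (x , y) y w ≡ eqℕ w x
joins-snd {x} {y} w x≢y rewrite eqℕ-refl y | eqℕ-≢ x≢y = trans (∧-identityʳ (eqℕ x w)) (eqℕ-sym x w)

chain-suc : ∀ s c → chain s (suc c) ≡ (s , suc s) ∷ chain (suc s) c
chain-suc s c rewrite +-comm s 1 = refl

adjℕ-chain-outside : ∀ c s v w → v ≢ 1 → v < s ⊎ s + c < v → adjℕ (chain s c) v w ≡ false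
adjℕ-chain-outside zero s v w v≢1 outside = cong (_∨ false) (joins-≢ w s≢v (≢-sym v≢1))
  where
  s≢v : s ≢ v
  s≢v = [ >⇒≢ , (λ s+0<v → <⇒≢ (≤-<-trans (m≤m+n s 0) s+0<v)) ]′ outside
adjℕ-chain-outside (suc c) s v w v≢1 outside =
  trans (cong (λ E → adjℕ E v w) (chain-suc s c))
        (cong₂ _∨_ (joins-≢ w s≢v 1+s≢v) (adjℕ-chain-outside c (suc s) v w v≢1 outside′))
  where
  s+1+c≡ : s + suc c ≡ suc s + c
  s+1+c≡ = +-suc s c
  s≢v : s ≢ v
  s≢v = [ >⇒≢ , (λ end<v → <⇒≢ (≤-<-trans (m≤m+n s (suc c)) end<v)) ]′ outside
  1+s≢v : suc s ≢ v
  1+s≢v = [ (λ v<s → >⇒≢ (<-trans v<s (n<1+n s))) , (λ end<v → <⇒≢ (≤-<-trans (m≤m+n (suc s) c) (subst (_< v) s+1+c≡ end<v))) ]′ outside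
  outside′ : v < suc s ⊎ suc s + c < v
  outside′ = Sum.map (λ v<s → <-trans v<s (n<1+n s)) (subst (_< v) s+1+c≡) outside

adjℕ-chain-1 : ∀ c s w → 2 ≤ s → adjℕ (chain s c) 1 w ≡ eqℕ w (s + c)
adjℕ-chain-1 zero s w 2≤s =
  trans (∨-identityʳ _) (trans (joins-snd w (≢-sym (<⇒≢ 2≤s))) (cong (eqℕ w) (sym (+-identityʳ s))))
adjℕ-chain-1 (suc c) s w 2≤s =
  trans (cong (λ E → adjℕ E 1 w) (chain-suc s c))
  (trans (cong₂ _∨_ (joins-≢ w (≢-sym (<⇒≢ 2≤s)) (≢-sym (<⇒≢ (<-trans 2≤s (n<1+n s)))))
                    (adjℕ-chain-1 c (suc s) w (≤-trans 2≤s (n≤1+n s))))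
         (cong (eqℕ w) (sym (+-suc s c))))

neighbour0 : ℕ → ℕ → ℕ
neighbour0 s zero    = 1
neighbour0 s (suc t) = s

neighbour1 : ℕ → ℕ → ℕ
neighbour1 s zero    = 0
neighbour1 s (suc t) = s + t

adjℕ-pathEdges-0 : ∀ t s w → 2 ≤ s → adjℕ (pathEdges s t) 0 w ≡ eqℕ w (neighbour0 s t)
adjℕ-pathEdges-0 zero    s w 2≤s = trans (∨-identityʳ _) (joins-fst {0} {1} w (λ ()))
adjℕ-pathEdges-0 (suc t) s w 2≤s =
  trans (cong₂ _∨_ (joins-fst {0} {s} w (>⇒≢ 0<s)) (adjℕ-chain-outside t s 0 w (λ ()) (inj₁ 0<s))) (∨-identityʳ _)
  where
  0<s : 0 < s
  0<s = <-trans (s≤s z≤n) 2≤s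

adjℕ-pathEdges-1 : ∀ t s w → 2 ≤ s → adjℕ (pathEdges s t) 1 w ≡ eqℕ w (neighbour1 s t)
adjℕ-pathEdges-1 zero    s w 2≤s = trans (∨-identityʳ _) (joins-snd {0} {1} w (λ ()))
adjℕ-pathEdges-1 (suc t) s w 2≤s = cong₂ _∨_ (joins-≢ {0} {s} {1} w (λ ()) (≢-sym (<⇒≢ 2≤s))) (adjℕ-chain-1 t s w 2≤s)

adjℕ-pathEdges-outside : ∀ t s v w → v ≢ 0 → v ≢ 1 → v < s ⊎ s + t ≤ v → adjℕ (pathEdges s t) v w ≡ false
adjℕ-pathEdges-outside zero    s v w v≢0 v≢1 outside =
  trans (∨-identityʳ _) (joins-≢ {0} {1} {v} w (≢-sym v≢0) (≢-sym v≢1))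
adjℕ-pathEdges-outside (suc t) s v w v≢0 v≢1 outside =
  cong₂ _∨_ (joins-≢ {0} {s} {v} w (≢-sym v≢0) s≢v) (adjℕ-chain-outside t s v w v≢1 outside′)
  where
  s≢v : s ≢ v
  s≢v = [ >⇒≢ , (λ end≤v → <⇒≢ (<-≤-trans (m<m+n s (s≤s z≤n)) end≤v)) ]′ outside
  outside′ : v < s ⊎ s + t < v
  outside′ = Sum.map id (subst (_≤ v) (+-suc s t)) outside

Rows≗ : List (ℕ → Bool) → List (ℕ → Bool) → Set
Rows≗ = Pointwise _≗_

perm₂-≗ : ∀ {rs rs′} → Rows≗ rs rs′ → ∀ L → perm₂ rs L ≡ perm₂ rs′ L
perm₂-≗ []          L = refl
perm₂-≗ (r≗r′ ∷ eq) L = pickXor-cong L (λ d R → cong₂ _∧_ (r≗r′ d) (perm₂-≗ eq R))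

Rows≗-trans : ∀ {rs rs′ rs″} → Rows≗ rs rs′ → Rows≗ rs′ rs″ → Rows≗ rs rs″
Rows≗-trans = Pointwise.transitive (λ r≗r′ r′≗r″ w → trans (r≗r′ w) (r′≗r″ w))

map-≗ : ∀ {P : ℕ → Set} {L} (f g : ℕ → ℕ → Bool) → All P L → (∀ {v} → P v → f v ≗ g v) → Rows≗ (map f L) (map g L)
map-≗ f g []         f≗g = []
map-≗ f g (Pv ∷ PL)  f≗g = f≗g Pv ∷ map-≗ f g PL f≗g

range-bounds : ∀ s n → All (λ v → s ≤ v × v < s + n) (range s n)
range-bounds s zero    = []
range-bounds s (suc n) = (≤-refl , subst (s <_) (sym (+-suc s n)) (s≤s (m≤m+n s n)))
  ∷ All-map (λ { {v} (1+s≤v , v<end) → (≤-trans (n≤1+n s) 1+s≤v , subst (v <_) (sym (+-suc s n)) v<end) }) (range-bounds (suc s) n)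

chainRows : ∀ c x s → x < s → 2 ≤ s → Rows≗ (map (adjℕ ((x , s) ∷ chain s c)) (range s (suc c))) (pathRows x s (suc c) 1)
chainRows zero x s x<s 2≤s =
  (λ w → cong₂ _∨_ (joins-snd {x} {s} w (<⇒≢ x<s)) (trans (∨-identityʳ _) (joins-fst {s} {1} w (<⇒≢ 2≤s)))) ∷ []
chainRows (suc c) x s x<s 2≤s = firstRow ∷ Rows≗-trans (map-≗ _ _ (range-bounds (suc s) (suc c)) laterRows)
                                                         (chainRows c s (suc s) (n<1+n s) (≤-trans 2≤s (n≤1+n s)))
  where
  firstRow : adjℕ ((x , s) ∷ chain s (suc c)) s ≗ pairRow x (suc s)
  firstRow w = cong₂ _∨_ (joins-snd {x} {s} w (<⇒≢ x<s))
    (trans (cong (λ E → adjℕ E s w) (chain-suc s c))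
           (trans (cong₂ _∨_ (joins-fst {s} {suc s} w (>⇒≢ (n<1+n s)))
                             (adjℕ-chain-outside c (suc s) s w (≢-sym (<⇒≢ 2≤s)) (inj₁ (n<1+n s))))
                  (∨-identityʳ _)))
  laterRows : ∀ {v} → suc s ≤ v × v < suc s + suc c → adjℕ ((x , s) ∷ chain s (suc c)) v ≗ adjℕ ((s , suc s) ∷ chain (suc s) c) v
  laterRows {v} (1+s≤v , _) w =
    cong₂ _∨_ (joins-≢ {x} {s} {v} w (<⇒≢ (<-trans x<s s<v)) (<⇒≢ s<v)) (cong (λ E → adjℕ E v w) (chain-suc s c))
    where
    s<v : s < v
    s<v = <-≤-trans (n<1+n s) 1+s≤v

pathEdgesRows : ∀ t s → 2 ≤ s → Rows≗ (map (adjℕ (pathEdges s t)) (range s t)) (pathRows 0 s t 1)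
pathEdgesRows zero    s 2≤s = []
pathEdgesRows (suc c) s 2≤s = chainRows c 0 s (<-trans (s≤s z≤n) 2≤s) 2≤s

row0 : ℕ → ℕ → ℕ → ℕ → Bool
row0 a b c w = eqℕ w (neighbour0 2 a) ∨ (eqℕ w (neighbour0 (2 + a) b) ∨ eqℕ w (neighbour0 (a + (2 + b)) c))

row1 : ℕ → ℕ → ℕ → ℕ → Bool
row1 a b c w = eqℕ w (neighbour1 2 a) ∨ (eqℕ w (neighbour1 (2 + a) b) ∨ eqℕ w (neighbour1 (a + (2 + b)) c))

-- θ(a+2, b+2, c+2): its three paths have a, b and c internal vertices, starting at 2, startB and startC.
module Theta (a b c : ℕ) where
  startB = 2 + a
  startC = a + (2 + b)
  edges = thetaEdges (2 + a) (2 + b) (2 + c)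

  adjℕ-edges : ∀ v w → adjℕ edges v w ≡ adjℕ (pathEdges 2 a) v w ∨ (adjℕ (pathEdges startB b) v w ∨ adjℕ (pathEdges startC c) v w)
  adjℕ-edges v w = trans (adjℕ-++ (pathEdges 2 a) _ v w) (cong (adjℕ (pathEdges 2 a) v w ∨_) (adjℕ-++ (pathEdges startB b) _ v w))

  startB+b : startB + b ≡ startC
  startB+b = sym (trans (+-suc a (suc b)) (cong suc (+-suc a b)))

  startB≤startC : startB ≤ startC
  startB≤startC = subst (startB ≤_) startB+b (m≤m+n startB b)

  2≤startB : 2 ≤ startB
  2≤startB = s≤s (s≤s z≤n)

  2≤startC : 2 ≤ startC
  2≤startC = ≤-trans 2≤startB startB≤startC

  ≢0 : ∀ {v} → 2 ≤ v → v ≢ 0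
  ≢0 2≤v = >⇒≢ (<-trans (s≤s z≤n) 2≤v)

  ≢1 : ∀ {v} → 2 ≤ v → v ≢ 1
  ≢1 2≤v = >⇒≢ 2≤v

  rowsA : Rows≗ (map (adjℕ edges) (range 2 a)) (pathRows 0 2 a 1)
  rowsA = Rows≗-trans (map-≗ _ _ (range-bounds 2 a) onlyA) (pathEdgesRows a 2 ≤-refl)
    where
    onlyA : ∀ {v} → 2 ≤ v × v < 2 + a → adjℕ edges v ≗ adjℕ (pathEdges 2 a) v
    onlyA {v} (2≤v , v<) w = trans (adjℕ-edges v w) (trans (cong (adjℕ (pathEdges 2 a) v w ∨_)
      (cong₂ _∨_ (adjℕ-pathEdges-outside b startB v w (≢0 2≤v) (≢1 2≤v) (inj₁ v<))
                 (adjℕ-pathEdges-outside c startC v w (≢0 2≤v) (≢1 2≤v) (inj₁ (<-≤-trans v< startB≤startC))))) (∨-identityʳ _))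

  rowsB : Rows≗ (map (adjℕ edges) (range startB b)) (pathRows 0 startB b 1)
  rowsB = Rows≗-trans (map-≗ _ _ (range-bounds startB b) onlyB) (pathEdgesRows b startB 2≤startB)
    where
    onlyB : ∀ {v} → startB ≤ v × v < startB + b → adjℕ edges v ≗ adjℕ (pathEdges startB b) v
    onlyB {v} (start≤v , v<) w = trans (adjℕ-edges v w)
      (cong₂ _∨_ (adjℕ-pathEdges-outside a 2 v w (≢0 2≤v) (≢1 2≤v) (inj₂ start≤v))
        (trans (cong (adjℕ (pathEdges startB b) v w ∨_)
                     (adjℕ-pathEdges-outside c startC v w (≢0 2≤v) (≢1 2≤v) (inj₁ (subst (v <_) startB+b v<))))
               (∨-identityʳ _)))
      where 2≤v = ≤-trans 2≤startB start≤v

  rowsC : Rows≗ (map (adjℕ edges) (range startC c)) (pathRows 0 startC c 1)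
  rowsC = Rows≗-trans (map-≗ _ _ (range-bounds startC c) onlyC) (pathEdgesRows c startC 2≤startC)
    where
    onlyC : ∀ {v} → startC ≤ v × v < startC + c → adjℕ edges v ≗ adjℕ (pathEdges startC c) v
    onlyC {v} (start≤v , _) w = trans (adjℕ-edges v w)
      (cong₂ _∨_ (adjℕ-pathEdges-outside a 2 v w (≢0 2≤v) (≢1 2≤v) (inj₂ (≤-trans startB≤startC start≤v)))
                 (cong (_∨ adjℕ (pathEdges startC c) v w)
                       (adjℕ-pathEdges-outside b startB v w (≢0 2≤v) (≢1 2≤v) (inj₂ (subst (_≤ v) (sym startB+b) start≤v)))))
      where 2≤v = ≤-trans 2≤startC start≤v

  pathBlock : List (ℕ → Bool)
  pathBlock = pathRows 0 2 a 1 ++ pathRows 0 startB b 1 ++ pathRows 0 startC c 1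

  rows : Rows≗ (map (adjℕ edges) (0 ∷ 1 ∷ range 2 a ++ range startB b ++ range startC c)) (row0 a b c ∷ row1 a b c ∷ pathBlock)
  rows = (λ w → trans (adjℕ-edges 0 w) (cong₂ _∨_ (adjℕ-pathEdges-0 a 2 w ≤-refl)
                                        (cong₂ _∨_ (adjℕ-pathEdges-0 b startB w 2≤startB) (adjℕ-pathEdges-0 c startC w 2≤startC))))
       ∷ (λ w → trans (adjℕ-edges 1 w) (cong₂ _∨_ (adjℕ-pathEdges-1 a 2 w ≤-refl)
                                        (cong₂ _∨_ (adjℕ-pathEdges-1 b startB w 2≤startB) (adjℕ-pathEdges-1 c startC w 2≤startC))))
       ∷ subst (λ X → Rows≗ X pathBlock)
           (sym (trans (map-++ (adjℕ edges) (range 2 a) _) (cong (map (adjℕ edges) (range 2 a) ++_) (map-++ (adjℕ edges) (range startB b) _))))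
           (Pointwise.++⁺ rowsA (Pointwise.++⁺ rowsB rowsC))

data Even : ℕ → Set where
  even0  : Even 0
  even+2 : ∀ n → Even (suc (suc (2 * n)))

isZero : ∀ {t} → Even t → Bool
isZero even0      = true
isZero (even+2 n) = false

-- The columns s, …, s+t−1 of a path's internal vertices, the first present when β and the last when γ.
segment : ℕ → ℕ → Bool → Bool → List ℕ
segment s zero    β γ = []
segment s (suc r) β γ = opt β s ++ tailColumns s r γ

segment-bounds : ∀ s t β γ → All (λ w → s ≤ w × w < s + t) (segment s t β γ)
segment-bounds s zero    β γ = []
segment-bounds s (suc r) β γ = ++⁺ (All-opt β s (≤-refl , m<m+n s (s≤s z≤n)))
  (All-map (λ { {w} (s<w , w≤) → <⇒≤ s<w , subst (w <_) (sym (+-suc s r)) (s≤s w≤) }) (tailColumns-bounds s r γ))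

evenPathWeight : Bool → Bool → Bool → Bool → Bool → Bool
evenPathWeight true  α δ β γ = true
evenPathWeight false α δ β γ = (γ ∨ α) ∧ (β ∨ δ)

xSurvives : Bool → Bool → Bool → Bool
xSurvives true  α γ = α
xSurvives false α γ = α ∧ γ

ySurvives : Bool → Bool → Bool → Bool
ySurvives true  δ β = δ
ySurvives false δ β = δ ∧ β

perm₂-evenPath : ∀ {t} (ev : Even t) x s y α δ β γ ls M → x < s → y < s → x ≢ y →
  (∀ w → s ≤ w → w < s + t → ColumnZero w ls) → All (λ w → (w < s × w ≢ x × w ≢ y) ⊎ s + t ≤ w) M →
  perm₂ (pathRows x s t y ++ ls) (opt α x ++ opt δ y ++ segment s t β γ ++ M)
    ≡ evenPathWeight (isZero ev) α δ β γ ∧ perm₂ ls (opt (xSurvives (isZero ev) α γ) x ++ opt (ySurvives (isZero ev) δ β) y ++ M)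
perm₂-evenPath even0      x s y α δ β γ ls M x<s y<s x≢y zeroOnPath inert = refl
perm₂-evenPath (even+2 n) x s y α δ β γ ls M x<s y<s x≢y zeroOnPath inert =
  trans (cong (λ X → perm₂ (pathRows x s (suc (suc (2 * n))) y ++ ls) (opt α x ++ opt δ y ++ X))
              (++-assoc (opt β s) (tailColumns s (suc (2 * n)) γ) M))
        (perm₂-evenPath⁺ n x s y α δ β γ ls M x<s y<s x≢y
          (λ w s≤w w≤ → zeroOnPath w s≤w (subst (w <_) (sym end≡) (s≤s w≤)))
          (All-map (λ { (inj₁ below) → inj₁ below ; {w} (inj₂ end≤w) → inj₂ (subst (_≤ w) end≡ end≤w) }) inert))
  where
  end≡ : s + suc (suc (2 * n)) ≡ suc (suc (s + 2 * n))
  end≡ = trans (+-suc s (suc (2 * n))) (cong suc (+-suc s (2 * n)))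

-- The flags of `columns` say which of the columns 0 and 1 and which end columns of the three
-- paths are present.
module Paths {a b c : ℕ} (ea : Even a) (eb : Even b) (ec : Even c) where
  open Theta a b c using (startB; startC; startB+b; startB≤startC; 2≤startB; 2≤startC; ≢0; ≢1; pathBlock)

  columns : Bool → Bool → Bool → Bool → Bool → Bool → Bool → Bool → List ℕ
  columns α δ βA γA βB γB βC γC = opt α 0 ++ opt δ 1 ++ segment 2 a βA γA ++ segment startB b βB γB ++ segment startC c βC γC

  afterPaths : Bool → Bool → Bool → Bool → Bool → Bool → Bool → Bool → Bool
  afterPaths α δ βA γA βB γB βC γC =
    let zA = isZero ea ; zB = isZero eb ; zC = isZero ec
        α₁ = xSurvives zA α γA  ; δ₁ = ySurvives zA δ βA
        α₂ = xSurvives zB α₁ γB ; δ₂ = ySurvives zB δ₁ βB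
        α₃ = xSurvives zC α₂ γC ; δ₃ = ySurvives zC δ₂ βC
    in evenPathWeight zA α δ βA γA ∧ (evenPathWeight zB α₁ δ₁ βB γB ∧ (evenPathWeight zC α₂ δ₂ βC γC ∧ perm₂ [] (opt α₃ 0 ++ opt δ₃ 1 ++ [])))

  perm₂-pathBlock : ∀ α δ βA γA βB γB βC γC → perm₂ pathBlock (columns α δ βA γA βB γB βC γC) ≡ afterPaths α δ βA γA βB γB βC γC
  perm₂-pathBlock α δ βA γA βB γB βC γC =
    trans (perm₂-evenPath ea 0 2 1 α δ βA γA (pathRows 0 startB b 1 ++ pathRows 0 startC c 1) (segB ++ segC) 0<2 1<2 (λ ())
            (λ w 2≤w w< → ++⁺ (pathRows-columnZero b 0 startB 1 w (≢0 2≤w) (≢1 2≤w) w<)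
                               (pathRows-columnZero c 0 startC 1 w (≢0 2≤w) (≢1 2≤w) (<-≤-trans w< startB≤startC)))
            (++⁺ (All-map (λ (start≤w , _) → inj₂ start≤w) (segment-bounds startB b βB γB))
                 (All-map (λ (start≤w , _) → inj₂ (≤-trans startB≤startC start≤w)) (segment-bounds startC c βC γC))))
    (cong (evenPathWeight (isZero ea) α δ βA γA ∧_)
    (trans (perm₂-evenPath eb 0 startB 1 α₁ δ₁ βB γB (pathRows 0 startC c 1) segC (<-≤-trans 0<2 2≤startB) (<-≤-trans 1<2 2≤startB) (λ ())
            (λ w start≤w w< → pathRows-columnZero c 0 startC 1 w (≢0 (≤-trans 2≤startB start≤w)) (≢1 (≤-trans 2≤startB start≤w)) (subst (w <_) startB+b w<))
            (All-map (λ { {w} (start≤w , _) → inj₂ (subst (_≤ w) (sym startB+b) start≤w) }) (segment-bounds startC c βC γC)))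
    (cong (evenPathWeight (isZero eb) α₁ δ₁ βB γB ∧_)
    (trans (cong₂ (λ X Y → perm₂ X (opt α₂ 0 ++ opt δ₂ 1 ++ Y)) (sym (++-identityʳ (pathRows 0 startC c 1))) (sym (++-identityʳ segC)))
           (perm₂-evenPath ec 0 startC 1 α₂ δ₂ βC γC [] [] (<-≤-trans 0<2 2≤startC) (<-≤-trans 1<2 2≤startC) (λ ()) (λ _ _ _ → []) [])))))
    where
    0<2 : 0 < 2
    0<2 = s≤s z≤n
    1<2 : 1 < 2
    1<2 = s≤s (s≤s z≤n)
    segB = segment startB b βB γB
    segC = segment startC c βC γC
    α₁ = xSurvives (isZero ea) α γA
    δ₁ = ySurvives (isZero ea) δ βA
    α₂ = xSurvives (isZero eb) α₁ γB
    δ₂ = ySurvives (isZero eb) δ₁ βB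

pickXor-unitAt : ∀ ρ (g : List ℕ → Bool) P₁ P₂ c P₃ Q → RowZero ρ P₁ → RowZero ρ P₂ → RowZero ρ P₃ → ρ c ≡ true →
  pickXor (P₁ ++ P₂ ++ c ∷ P₃ ++ Q) (λ d R → ρ d ∧ g R)
    ≡ g (P₁ ++ P₂ ++ P₃ ++ Q) xor pickXor Q (λ d R → ρ d ∧ g (P₁ ++ P₂ ++ c ∷ P₃ ++ R))
pickXor-unitAt ρ g P₁ P₂ c P₃ Q ρ0₁ ρ0₂ ρ0₃ ρc≡1 =
  trans (pickXor-skipZero ρ g P₁ _ ρ0₁) (trans (pickXor-skipZero ρ (λ R → g (P₁ ++ R)) P₂ _ ρ0₂)
    (cong₂ _xor_ (cong (_∧ g (P₁ ++ P₂ ++ P₃ ++ Q)) ρc≡1) (pickXor-skipZero ρ (λ R → g (P₁ ++ P₂ ++ c ∷ R)) P₃ Q ρ0₃)))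

pickXor-opt : ∀ α c Q (h : ℕ → List ℕ → Bool) → pickXor (opt α c ++ Q) h ≡ (α ∧ h c Q) xor pickXor Q (λ d R → h d (opt α c ++ R))
pickXor-opt true  c Q h = refl
pickXor-opt false c Q h = refl

StartsPath : ∀ {t} → Even t → ℕ → Bool → (ℕ → Bool) → Set
StartsPath even0      s γ ρ = ⊤
StartsPath (even+2 n) s γ ρ = ρ s ≡ true × RowZero ρ (tailColumns s (suc (2 * n)) γ)

pickXor-pathStart : ∀ {t} (ev : Even t) s γ ρ (g : List ℕ → Bool) Q → StartsPath ev s γ ρ →
  pickXor (segment s t true γ ++ Q) (λ d R → ρ d ∧ g R)
    ≡ (not (isZero ev) ∧ g (segment s t false γ ++ Q)) xor pickXor Q (λ d R → ρ d ∧ g (segment s t true γ ++ R))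
pickXor-pathStart even0      s γ ρ g Q _ = refl
pickXor-pathStart (even+2 n) s γ ρ g Q (ρs≡1 , ρ0) = pickXor-unitAt ρ g [] [] s (tailColumns s (suc (2 * n)) γ) Q [] [] ρ0 ρs≡1

EndsPath : ∀ {t} → Even t → ℕ → Bool → (ℕ → Bool) → Set
EndsPath even0      s β ρ = ⊤
EndsPath (even+2 n) s β ρ = RowZero ρ (opt β s) × RowZero ρ (tailColumns s (suc (2 * n)) false) × ρ (s + suc (2 * n)) ≡ true

tailColumns-true : ∀ u k → tailColumns u (suc k) true ≡ tailColumns u (suc k) false ++ [ u + suc k ]
tailColumns-true u zero    = cong [_] (+-comm 1 u)
tailColumns-true u (suc k) = cong (suc u ∷_) (trans (tailColumns-true (suc u) k)
                                                    (cong (λ z → tailColumns (suc u) (suc k) false ++ [ z ]) (sym (+-suc u (suc k)))))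

segment-last : ∀ β s k R → (opt β s ++ tailColumns s (suc k) true) ++ R ≡ opt β s ++ tailColumns s (suc k) false ++ (s + suc k) ∷ R
segment-last β s k R = trans (++-assoc (opt β s) _ R) (cong (opt β s ++_)
  (trans (cong (_++ R) (tailColumns-true s k)) (++-assoc (tailColumns s (suc k) false) [ s + suc k ] R)))

pickXor-pathEnd : ∀ {t} (ev : Even t) s β ρ (g : List ℕ → Bool) Q → EndsPath ev s β ρ →
  pickXor (segment s t β true ++ Q) (λ d R → ρ d ∧ g R)
    ≡ (not (isZero ev) ∧ g (segment s t β false ++ Q)) xor pickXor Q (λ d R → ρ d ∧ g (segment s t β true ++ R))
pickXor-pathEnd even0      s β ρ g Q _ = refl
pickXor-pathEnd (even+2 n) s β ρ g Q (ρ0₁ , ρ0₂ , ρend≡1) =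
  trans (cong (λ X → pickXor X (λ d R → ρ d ∧ g R)) (segment-last β s (2 * n) Q))
  (trans (pickXor-unitAt ρ g (opt β s) (tailColumns s (suc (2 * n)) false) (s + suc (2 * n)) [] Q ρ0₁ ρ0₂ [] ρend≡1)
         (cong₂ _xor_ (cong g (sym (++-assoc (opt β s) (tailColumns s (suc (2 * n)) false) Q)))
                      (pickXor-cong Q (λ d R → cong (λ X → ρ d ∧ g X) (sym (segment-last β s (2 * n) R))))))

≢neighbour0 : ∀ t s {w} → w ≢ 1 → w ≢ s → w ≢ neighbour0 s t
≢neighbour0 zero    s w≢1 w≢s = w≢1
≢neighbour0 (suc t) s w≢1 w≢s = w≢s

≢neighbour1 : ∀ t s {w} → w ≢ 0 → w < s ⊎ s + t ≤ w → w ≢ neighbour1 s t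
≢neighbour1 zero    s w≢0 _              = w≢0
≢neighbour1 (suc t) s w≢0 (inj₁ w<s)     = <⇒≢ (<-≤-trans w<s (m≤m+n s t))
≢neighbour1 (suc t) s w≢0 (inj₂ end≤w)   = >⇒≢ (<-≤-trans (+-monoʳ-< s (n<1+n t)) end≤w)

eqℕ-1-neighbour0 : ∀ {t} (ev : Even t) s → 2 ≤ s → eqℕ 1 (neighbour0 s t) ≡ isZero ev
eqℕ-1-neighbour0 even0      s 2≤s = refl
eqℕ-1-neighbour0 (even+2 n) s 2≤s = eqℕ-≢ (<⇒≢ 2≤s)

eqℕ-0-neighbour1 : ∀ {t} (ev : Even t) s → 2 ≤ s → eqℕ 0 (neighbour1 s t) ≡ isZero ev
eqℕ-0-neighbour1 even0      s 2≤s = refl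
eqℕ-0-neighbour1 (even+2 n) s 2≤s = eqℕ-≢ (<⇒≢ (<-≤-trans (s≤s z≤n) (≤-trans 2≤s (m≤m+n s _))))

row0-≢ : ∀ a b c {w} → w ≢ neighbour0 2 a → w ≢ neighbour0 (2 + a) b → w ≢ neighbour0 (a + (2 + b)) c → row0 a b c w ≡ false
row0-≢ a b c w≢A w≢B w≢C = cong₂ _∨_ (eqℕ-≢ w≢A) (cong₂ _∨_ (eqℕ-≢ w≢B) (eqℕ-≢ w≢C))

row1-≢ : ∀ a b c {w} → w ≢ neighbour1 2 a → w ≢ neighbour1 (2 + a) b → w ≢ neighbour1 (a + (2 + b)) c → row1 a b c w ≡ false
row1-≢ a b c w≢A w≢B w≢C = cong₂ _∨_ (eqℕ-≢ w≢A) (cong₂ _∨_ (eqℕ-≢ w≢B) (eqℕ-≢ w≢C))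

tailColumns-false-bounds : ∀ u k → All (λ w → u < w × w < u + k) (tailColumns u k false)
tailColumns-false-bounds u zero          = []
tailColumns-false-bounds u (suc zero)    = []
tailColumns-false-bounds u (suc (suc k)) =
  (≤-refl , subst (suc u <_) (sym (+-suc u (suc k))) (s≤s (m<m+n u (s≤s z≤n))))
  ∷ All-map (λ { {w} (1+u<w , w<) → <-trans (n<1+n u) 1+u<w , subst (w <_) (sym (+-suc u (suc k))) w< })
            (tailColumns-false-bounds (suc u) (suc k))

module _ (a b c : ℕ) where
  open Theta a b c using (startB; startC; startB+b; startB≤startC; 2≤startB; 2≤startC; ≢0)

  row0-0 : row0 a b c 0 ≡ false
  row0-0 = row0-≢ a b c (≢neighbour0 a 2 (λ ()) (λ ())) (≢neighbour0 b startB (λ ()) (λ ())) (≢neighbour0 c startC (λ ()) (≢-sym (≢0 2≤startC)))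

  row1-1 : row1 a b c 1 ≡ false
  row1-1 = row1-≢ a b c (≢neighbour1 a 2 (λ ()) (inj₁ 1<2)) (≢neighbour1 b startB (λ ()) (inj₁ (<-≤-trans 1<2 2≤startB)))
                        (≢neighbour1 c startC (λ ()) (inj₁ (<-≤-trans 1<2 2≤startC)))
    where
    1<2 : 1 < 2
    1<2 = s≤s (s≤s z≤n)

  row0-1 : (ea : Even a) (eb : Even b) (ec : Even c) → row0 a b c 1 ≡ isZero ea ∨ (isZero eb ∨ isZero ec)
  row0-1 ea eb ec = cong₂ _∨_ (eqℕ-1-neighbour0 ea 2 ≤-refl) (cong₂ _∨_ (eqℕ-1-neighbour0 eb startB 2≤startB) (eqℕ-1-neighbour0 ec startC 2≤startC))

  row1-0 : (ea : Even a) (eb : Even b) (ec : Even c) → row1 a b c 0 ≡ isZero ea ∨ (isZero eb ∨ isZero ec)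
  row1-0 ea eb ec = cong₂ _∨_ (eqℕ-0-neighbour1 ea 2 ≤-refl) (cong₂ _∨_ (eqℕ-0-neighbour1 eb startB 2≤startB) (eqℕ-0-neighbour1 ec startC 2≤startC))

row0-startsA : ∀ {a} b c (ea : Even a) γ → StartsPath ea 2 γ (row0 a b c)
row0-startsA b c even0      γ = tt
row0-startsA b c (even+2 n) γ = refl , All-map vanishes (tailColumns-bounds 2 (suc (2 * n)) γ)
  where
  open Theta (suc (suc (2 * n))) b c using (startB; startC; startB≤startC)
  vanishes : ∀ {w} → 2 < w × w ≤ 2 + suc (2 * n) → row0 (suc (suc (2 * n))) b c w ≡ false
  vanishes (2<w , w≤) = row0-≢ (suc (suc (2 * n))) b c (>⇒≢ 2<w) (≢neighbour0 b startB (>⇒≢ (<-trans (s≤s (s≤s z≤n)) 2<w)) (<⇒≢ (s≤s w≤)))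
                                               (≢neighbour0 c startC (>⇒≢ (<-trans (s≤s (s≤s z≤n)) 2<w)) (<⇒≢ (<-≤-trans (s≤s w≤) startB≤startC)))

row0-startsB : ∀ a {b} c (eb : Even b) γ → StartsPath eb (2 + a) γ (row0 a b c)
row0-startsB a c even0      γ = tt
row0-startsB a c (even+2 n) γ =
  trans (cong (eqℕ startB (neighbour0 2 a) ∨_) (cong (_∨ eqℕ startB (neighbour0 startC c)) (eqℕ-refl startB))) (∨-zeroʳ _)
  , All-map vanishes (tailColumns-bounds startB (suc (2 * n)) γ)
  where
  open Theta a (suc (suc (2 * n))) c using (startB; startC; startB+b; 2≤startB; ≢1)
  end<startC : startB + suc (2 * n) < startC
  end<startC = subst (startB + suc (2 * n) <_) startB+b (+-monoʳ-< startB (n<1+n _))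
  vanishes : ∀ {w} → startB < w × w ≤ startB + suc (2 * n) → row0 a (suc (suc (2 * n))) c w ≡ false
  vanishes {w} (start<w , w≤) = row0-≢ a (suc (suc (2 * n))) c (≢neighbour0 a 2 (≢1 2≤w) (>⇒≢ (≤-<-trans 2≤startB start<w))) (>⇒≢ start<w)
                                              (≢neighbour0 c startC (≢1 2≤w) (<⇒≢ (≤-<-trans w≤ end<startC)))
    where 2≤w = ≤-trans 2≤startB (<⇒≤ start<w)

row0-startsC : ∀ a b {c} (ec : Even c) γ → StartsPath ec (a + (2 + b)) γ (row0 a b c)
row0-startsC a b even0      γ = tt
row0-startsC a b (even+2 n) γ =
  trans (cong (eqℕ startC (neighbour0 2 a) ∨_) (trans (cong (eqℕ startC (neighbour0 startB b) ∨_) (eqℕ-refl startC)) (∨-zeroʳ _))) (∨-zeroʳ _)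
  , All-map vanishes (tailColumns-bounds startC (suc (2 * n)) γ)
  where
  open Theta a b (suc (suc (2 * n))) using (startB; startC; startB≤startC; 2≤startC; ≢1)
  vanishes : ∀ {w} → startC < w × w ≤ startC + suc (2 * n) → row0 a b (suc (suc (2 * n))) w ≡ false
  vanishes {w} (start<w , _) = row0-≢ a b (suc (suc (2 * n))) (≢neighbour0 a 2 (≢1 2≤w) (>⇒≢ (≤-<-trans 2≤startC start<w)))
                                             (≢neighbour0 b startB (≢1 2≤w) (>⇒≢ (≤-<-trans startB≤startC start<w))) (>⇒≢ start<w)
    where 2≤w = ≤-trans 2≤startC (<⇒≤ start<w)

row1-endsA : ∀ {a} b c (ea : Even a) β → EndsPath ea 2 β (row1 a b c)
row1-endsA b c even0      β = tt
row1-endsA b c (even+2 n) β =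
  All-opt β 2 (vanishes (inj₁ refl))
  , All-map (λ (2<w , w<end) → vanishes (inj₂ (2<w , w<end))) (tailColumns-false-bounds 2 (suc (2 * n)))
  , cong (_∨ (eqℕ end (neighbour1 startB b) ∨ eqℕ end (neighbour1 startC c))) (eqℕ-refl end)
  where
  open Theta (suc (suc (2 * n))) b c using (startB; startC; startB≤startC)
  end = 2 + suc (2 * n)
  vanishes : ∀ {w} → w ≡ 2 ⊎ (2 < w × w < end) → row1 (suc (suc (2 * n))) b c w ≡ false
  vanishes {w} at = row1-≢ (suc (suc (2 * n))) b c (<⇒≢ w<end) (≢neighbour1 b startB w≢0 (inj₁ w<startB)) (≢neighbour1 c startC w≢0 (inj₁ (<-≤-trans w<startB startB≤startC)))
    where
    w<end : w < end
    w<end = [ (λ { refl → s≤s (s≤s (s≤s z≤n)) }) , (λ (_ , w<) → w<) ]′ at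
    w≢0 : w ≢ 0
    w≢0 = [ (λ { refl () }) , (λ (2<w , _) → >⇒≢ (<-trans (s≤s z≤n) (<⇒≤ 2<w))) ]′ at
    w<startB : w < startB
    w<startB = <-trans w<end (n<1+n end)

row1-endsB : ∀ a {b} c (eb : Even b) β → EndsPath eb (2 + a) β (row1 a b c)
row1-endsB a c even0      β = tt
row1-endsB a c (even+2 n) β =
  All-opt β startB (vanishes ≤-refl (m<m+n startB (s≤s z≤n)))
  , All-map (λ (start<w , w<end) → vanishes (<⇒≤ start<w) w<end) (tailColumns-false-bounds startB (suc (2 * n)))
  , trans (cong (eqℕ end (neighbour1 2 a) ∨_) (cong (_∨ eqℕ end (neighbour1 startC c)) (eqℕ-refl end))) (∨-zeroʳ _)
  where
  open Theta a (suc (suc (2 * n))) c using (startB; startC; startB+b; 2≤startB; ≢0)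
  end = startB + suc (2 * n)
  end<startC : end < startC
  end<startC = subst (end <_) startB+b (+-monoʳ-< startB (n<1+n _))
  vanishes : ∀ {w} → startB ≤ w → w < end → row1 a (suc (suc (2 * n))) c w ≡ false
  vanishes start≤w w<end = row1-≢ a (suc (suc (2 * n))) c (≢neighbour1 a 2 (≢0 (≤-trans 2≤startB start≤w)) (inj₂ start≤w)) (<⇒≢ w<end)
                                        (≢neighbour1 c startC (≢0 (≤-trans 2≤startB start≤w)) (inj₁ (<-trans w<end end<startC)))

row1-endsC : ∀ a b {c} (ec : Even c) β → EndsPath ec (a + (2 + b)) β (row1 a b c)
row1-endsC a b even0      β = tt
row1-endsC a b (even+2 n) β =
  All-opt β startC (vanishes ≤-refl (m<m+n startC (s≤s z≤n)))
  , All-map (λ (start<w , w<end) → vanishes (<⇒≤ start<w) w<end) (tailColumns-false-bounds startC (suc (2 * n)))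
  , trans (cong (eqℕ end (neighbour1 2 a) ∨_) (trans (cong (eqℕ end (neighbour1 startB b) ∨_) (eqℕ-refl end)) (∨-zeroʳ _))) (∨-zeroʳ _)
  where
  open Theta a b (suc (suc (2 * n))) using (startB; startC; startB+b; startB≤startC; 2≤startC; ≢0)
  end = startC + suc (2 * n)
  vanishes : ∀ {w} → startC ≤ w → w < end → row1 a b (suc (suc (2 * n))) w ≡ false
  vanishes {w} start≤w w<end = row1-≢ a b (suc (suc (2 * n))) (≢neighbour1 a 2 (≢0 (≤-trans 2≤startC start≤w)) (inj₂ (≤-trans startB≤startC start≤w)))
                                             (≢neighbour1 b startB (≢0 (≤-trans 2≤startC start≤w)) (inj₂ (subst (_≤ w) (sym startB+b) start≤w)))
                                             (<⇒≢ w<end)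

-- Expanding the rows of the branch vertices 0 and 1: only the columns 0 and 1 and the end columns
-- of the three paths meet them.
module Expansion {a b c : ℕ} (ea : Even a) (eb : Even b) (ec : Even c) where
  open Theta a b c using (startB; startC; pathBlock)
  open Paths {a} {b} {c} ea eb ec

  zA = isZero ea
  zB = isZero eb
  zC = isZero ec

  cong₅ : ∀ (f : Bool → Bool → Bool → Bool → Bool → Bool) {x₁ y₁ x₂ y₂ x₃ y₃ x₄ y₄ x₅ y₅} →
          x₁ ≡ y₁ → x₂ ≡ y₂ → x₃ ≡ y₃ → x₄ ≡ y₄ → x₅ ≡ y₅ → f x₁ x₂ x₃ x₄ x₅ ≡ f y₁ y₂ y₃ y₄ y₅
  cong₅ f refl refl refl refl refl = refl

  perm₂-row1 : ∀ α δ βA βB βC → perm₂ (row1 a b c ∷ pathBlock) (columns α δ βA true βB true βC true) ≡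
     (α ∧ (row1 a b c 0 ∧ perm₂ pathBlock (columns false δ βA true βB true βC true))) xor
     ((δ ∧ (row1 a b c 1 ∧ perm₂ pathBlock (columns α false βA true βB true βC true))) xor
     ((not zA ∧ perm₂ pathBlock (columns α δ βA false βB true βC true)) xor
     ((not zB ∧ perm₂ pathBlock (columns α δ βA true βB false βC true)) xor
     ((not zC ∧ perm₂ pathBlock (columns α δ βA true βB true βC false)) xor false))))
  perm₂-row1 α δ βA βB βC =
    trans (pickXor-opt α 0 (opt δ 1 ++ SA ++ SB ++ SC) h)
    (cong ((α ∧ h 0 (opt δ 1 ++ SA ++ SB ++ SC)) xor_)
    (trans (pickXor-opt δ 1 (SA ++ SB ++ SC) (λ d R → h d (opt α 0 ++ R)))
    (cong ((δ ∧ h 1 (opt α 0 ++ SA ++ SB ++ SC)) xor_)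
    (trans (pickXor-pathEnd ea 2 βA ρ g (SB ++ SC) (row1-endsA b c ea βA))
    (cong ((not zA ∧ g (segment 2 a βA false ++ SB ++ SC)) xor_)
    (trans (pickXor-pathEnd eb startB βB ρ (λ R → g (SA ++ R)) SC (row1-endsB a c eb βB))
    (cong ((not zB ∧ g (SA ++ segment startB b βB false ++ SC)) xor_)
    (trans (cong (λ X → pickXor X (λ d R → ρ d ∧ g (SA ++ SB ++ R))) (sym (++-identityʳ SC)))
    (trans (pickXor-pathEnd ec startC βC ρ (λ R → g (SA ++ SB ++ R)) [] (row1-endsC a b ec βC))
           (cong (λ X → (not zC ∧ g (SA ++ SB ++ X)) xor false) (++-identityʳ (segment startC c βC false))))))))))))
    where
    ρ = row1 a b c
    SA = segment 2 a βA true
    SB = segment startB b βB true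
    SC = segment startC c βC true
    h : ℕ → List ℕ → Bool
    h d R = ρ d ∧ perm₂ pathBlock R
    g : List ℕ → Bool
    g R = perm₂ pathBlock (opt α 0 ++ opt δ 1 ++ R)

  perm₂-row0 : perm₂ (row0 a b c ∷ row1 a b c ∷ pathBlock) (columns true true true true true true true true) ≡
     (row0 a b c 0 ∧ perm₂ (row1 a b c ∷ pathBlock) (columns false true true true true true true true)) xor
     ((row0 a b c 1 ∧ perm₂ (row1 a b c ∷ pathBlock) (columns true false true true true true true true)) xor
     ((not zA ∧ perm₂ (row1 a b c ∷ pathBlock) (columns true true false true true true true true)) xor
     ((not zB ∧ perm₂ (row1 a b c ∷ pathBlock) (columns true true true true false true true true)) xor
     ((not zC ∧ perm₂ (row1 a b c ∷ pathBlock) (columns true true true true true true false true)) xor false))))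
  perm₂-row0 =
    cong (λ X → (ρ 0 ∧ perm₂ (row1 a b c ∷ pathBlock) (1 ∷ SA ++ SB ++ SC)) xor ((ρ 1 ∧ perm₂ (row1 a b c ∷ pathBlock) (0 ∷ SA ++ SB ++ SC)) xor X))
    (trans (pickXor-pathStart ea 2 true ρ g (SB ++ SC) (row0-startsA b c ea true))
    (cong ((not zA ∧ g (segment 2 a false true ++ SB ++ SC)) xor_)
    (trans (pickXor-pathStart eb startB true ρ (λ R → g (SA ++ R)) SC (row0-startsB a c eb true))
    (cong ((not zB ∧ g (SA ++ segment startB b false true ++ SC)) xor_)
    (trans (cong (λ X → pickXor X (λ d R → ρ d ∧ g (SA ++ SB ++ R))) (sym (++-identityʳ SC)))
    (trans (pickXor-pathStart ec startC true ρ (λ R → g (SA ++ SB ++ R)) [] (row0-startsC a b ec true))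
           (cong (λ X → (not zC ∧ g (SA ++ SB ++ X)) xor false) (++-identityʳ (segment startC c false true)))))))))
    where
    ρ = row0 a b c
    SA = segment 2 a true true
    SB = segment startB b true true
    SC = segment startC c true true
    g : List ℕ → Bool
    g R = perm₂ (row1 a b c ∷ pathBlock) (0 ∷ 1 ∷ R)

  row1Value : Bool → Bool → Bool → Bool → Bool → Bool → Bool → Bool
  row1Value r₀ r₁ α δ βA βB βC =
     (α ∧ (r₀ ∧ afterPaths false δ βA true βB true βC true)) xor
     ((δ ∧ (r₁ ∧ afterPaths α false βA true βB true βC true)) xor
     ((not zA ∧ afterPaths α δ βA false βB true βC true) xor
     ((not zB ∧ afterPaths α δ βA true βB false βC true) xor
     ((not zC ∧ afterPaths α δ βA true βB true βC false) xor false))))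

  perm₂-row1-value : ∀ α δ βA βB βC →
    perm₂ (row1 a b c ∷ pathBlock) (columns α δ βA true βB true βC true) ≡ row1Value (row1 a b c 0) (row1 a b c 1) α δ βA βB βC
  perm₂-row1-value α δ βA βB βC = trans (perm₂-row1 α δ βA βB βC)
    (cong₅ (λ p q r s t → (α ∧ (row1 a b c 0 ∧ p)) xor ((δ ∧ (row1 a b c 1 ∧ q)) xor ((not zA ∧ r) xor ((not zB ∧ s) xor ((not zC ∧ t) xor false)))))
      (perm₂-pathBlock false δ βA true βB true βC true) (perm₂-pathBlock α false βA true βB true βC true)
      (perm₂-pathBlock α δ βA false βB true βC true) (perm₂-pathBlock α δ βA true βB false βC true) (perm₂-pathBlock α δ βA true βB true βC false))

  row0Value : Bool → Bool → Bool → Bool → Bool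
  row0Value r₀₀ r₀₁ r₁₀ r₁₁ =
     (r₀₀ ∧ row1Value r₁₀ r₁₁ false true true true true) xor
     ((r₀₁ ∧ row1Value r₁₀ r₁₁ true false true true true) xor
     ((not zA ∧ row1Value r₁₀ r₁₁ true true false true true) xor
     ((not zB ∧ row1Value r₁₀ r₁₁ true true true false true) xor
     ((not zC ∧ row1Value r₁₀ r₁₁ true true true true false) xor false))))

  perm₂-expansion : perm₂ (row0 a b c ∷ row1 a b c ∷ pathBlock) (columns true true true true true true true true)
                    ≡ row0Value false (zA ∨ (zB ∨ zC)) (zA ∨ (zB ∨ zC)) false
  perm₂-expansion = trans perm₂-row0 (trans
    (cong₅ (λ p q r s t → (row0 a b c 0 ∧ p) xor ((row0 a b c 1 ∧ q) xor ((not zA ∧ r) xor ((not zB ∧ s) xor ((not zC ∧ t) xor false)))))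
      (perm₂-row1-value false true true true true) (perm₂-row1-value true false true true true) (perm₂-row1-value true true false true true)
      (perm₂-row1-value true true true false true) (perm₂-row1-value true true true true false))
    (trans (cong₂ (λ p q → row0Value p q (row1 a b c 0) (row1 a b c 1)) (row0-0 a b c) (row0-1 a b c ea eb ec))
           (cong₂ (λ p q → row0Value false (zA ∨ (zB ∨ zC)) p q) (row1-0 a b c ea eb ec) (row1-1 a b c))))

row0Value≡true : ∀ {a b c} (ea : Even a) (eb : Even b) (ec : Even c) → ¬ (a ≡ 0 × b ≡ 0) → ¬ (a ≡ 0 × c ≡ 0) → ¬ (b ≡ 0 × c ≡ 0) →
  Expansion.row0Value ea eb ec false (isZero ea ∨ (isZero eb ∨ isZero ec)) (isZero ea ∨ (isZero eb ∨ isZero ec)) false ≡ true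
row0Value≡true even0      even0      ec         ab bc ac = ⊥-elim (ab (refl , refl))
row0Value≡true even0      (even+2 _) even0      ab bc ac = ⊥-elim (bc (refl , refl))
row0Value≡true (even+2 _) even0      even0      ab bc ac = ⊥-elim (ac (refl , refl))
row0Value≡true even0      (even+2 _) (even+2 _) ab bc ac = refl
row0Value≡true (even+2 _) even0      (even+2 _) ab bc ac = refl
row0Value≡true (even+2 _) (even+2 _) even0      ab bc ac = refl
row0Value≡true (even+2 _) (even+2 _) (even+2 _) ab bc ac = refl

tailColumns-range : ∀ u r → tailColumns u r true ≡ range (suc u) r
tailColumns-range u zero          = refl
tailColumns-range u (suc zero)    = refl
tailColumns-range u (suc (suc r)) = cong (suc u ∷_) (tailColumns-range (suc u) (suc r))

segment-range : ∀ s t → segment s t true true ≡ range s t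
segment-range s zero    = refl
segment-range s (suc r) = cong (s ∷_) (tailColumns-range s r)

range-++ : ∀ s m n → range s (m + n) ≡ range s m ++ range (s + m) n
range-++ s zero    n = cong (λ x → range x n) (sym (+-identityʳ s))
range-++ s (suc m) n = cong (s ∷_) (trans (range-++ (suc s) m n) (cong (λ x → range (suc s) m ++ range x n) (sym (+-suc s m))))

thetaOrder-2+ : ∀ a b c → thetaOrder (2 + a) (2 + b) (2 + c) ≡ 2 + (a + (b + c))
thetaOrder-2+ a b c = cong (_∸ 2) (sum-shape a b c)
  where
  sum-shape : ∀ a b c → a + (2 + b) + (2 + c) ≡ 4 + (a + (b + c))
  sum-shape = ℕ-Solver.solve-∀

perm₂-theta : ∀ {a b c} (ea : Even a) (eb : Even b) (ec : Even c) → ¬ (a ≡ 0 × b ≡ 0) → ¬ (a ≡ 0 × c ≡ 0) → ¬ (b ≡ 0 × c ≡ 0) →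
  let n = thetaOrder (2 + a) (2 + b) (2 + c) in
  perm₂ (map (adjℕ (thetaEdges (2 + a) (2 + b) (2 + c))) (range 0 n)) (range 0 n) ≡ true
perm₂-theta {a} {b} {c} ea eb ec ab ac bc rewrite thetaOrder-2+ a b c = begin
  perm₂ (map (adjℕ edges) vertices) vertices
    ≡⟨ cong (λ L → perm₂ (map (adjℕ edges) L) L) vertices≡ ⟩
  perm₂ (map (adjℕ edges) byPaths) byPaths
    ≡⟨ perm₂-≗ rows byPaths ⟩
  perm₂ (row0 a b c ∷ row1 a b c ∷ pathBlock) byPaths
    ≡⟨ cong (perm₂ (row0 a b c ∷ row1 a b c ∷ pathBlock)) byPaths≡columns ⟩
  perm₂ (row0 a b c ∷ row1 a b c ∷ pathBlock) (columns true true true true true true true true)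
    ≡⟨ Expansion.perm₂-expansion ea eb ec ⟩
  Expansion.row0Value ea eb ec false (isZero ea ∨ (isZero eb ∨ isZero ec)) (isZero ea ∨ (isZero eb ∨ isZero ec)) false
    ≡⟨ row0Value≡true ea eb ec ab ac bc ⟩
  true ∎
  where
  open ≡-Reasoning
  open Theta a b c using (startB; startC; startB+b; edges; pathBlock; rows)
  open Paths ea eb ec using (columns)
  vertices = range 0 (2 + (a + (b + c)))
  byPaths = 0 ∷ 1 ∷ range 2 a ++ range startB b ++ range startC c
  vertices≡ : vertices ≡ byPaths
  vertices≡ = cong (λ X → 0 ∷ 1 ∷ X)
    (trans (range-++ 2 a (b + c)) (cong (range 2 a ++_) (trans (range-++ startB b c) (cong (λ x → range startB b ++ range x c) startB+b))))
  byPaths≡columns : byPaths ≡ columns true true true true true true true true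
  byPaths≡columns = sym (cong (λ X → 0 ∷ 1 ∷ X) (cong₂ _++_ (segment-range 2 a) (cong₂ _++_ (segment-range startB b) (segment-range startC c))))

det₂-adjℕ : ∀ n es → det₂ n (λ i j → adjℕ es (toℕ i) (toℕ j)) ≡ perm₂ (map (adjℕ es) (range 0 n)) (range 0 n)
det₂-adjℕ n es = trans (det₂≡perm₂ n (λ i → adjℕ es (toℕ i)) toℕ)
                       (cong₂ perm₂ (tabulate-range n 0 (adjℕ es)) (trans (tabulate-range n 0 id) (map-id (range 0 n))))

even-2* : ∀ m → Even (2 * m)
even-2* zero    = even0
even-2* (suc m) = subst Even (sym (2*-suc m)) (even+2 m)

2*-≡0 : ∀ {m} → 2 * m ≡ 0 → suc m ≡ 1
2*-≡0 {zero} _ = refl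

det₂-thetaAdj : ∀ {p l q a b c} → p ≡ 2 + a → l ≡ 2 + b → q ≡ 2 + c → Even a → Even b → Even c →
  ¬ (a ≡ 0 × b ≡ 0) → ¬ (a ≡ 0 × c ≡ 0) → ¬ (b ≡ 0 × c ≡ 0) → det₂ (thetaOrder p l q) (thetaAdj p l q) ≡ true
det₂-thetaAdj {p} {l} {q} refl refl refl ea eb ec ab ac bc =
  trans (det₂-adjℕ (thetaOrder p l q) (thetaEdges p l q)) (perm₂-theta ea eb ec ab ac bc)

lemma3p5 : (m k l : ℕ) → 1 ≤ m → 1 ≤ k → 1 ≤ l →
    ¬ (m ≡ 1 × k ≡ 1) → ¬ (m ≡ 1 × l ≡ 1) → ¬ (k ≡ 1 × l ≡ 1) →
    (σ : Signature (thetaOrder (2 * m) (2 * k) (2 * l))) →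
    (∀ i j → σ i j ≡ σ j i) →
    det (thetaOrder (2 * m) (2 * k) (2 * l))
    (signedAdj (thetaAdj (2 * m) (2 * k) (2 * l)) σ) ≢ + 0
lemma3p5 (suc m) (suc k) (suc l) _ _ _ mk ml kl σ _ =
  det-signedAdj≢0 _ (thetaAdj (2 * suc m) (2 * suc k) (2 * suc l)) σ
    (det₂-thetaAdj (2*-suc m) (2*-suc k) (2*-suc l) (even-2* m) (even-2* k) (even-2* l)
      (λ (m≡ , k≡) → mk (2*-≡0 m≡ , 2*-≡0 k≡)) (λ (m≡ , l≡) → ml (2*-≡0 m≡ , 2*-≡0 l≡)) (λ (k≡ , l≡) → kl (2*-≡0 k≡ , 2*-≡0 l≡)))
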